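{- Let $f:\{0,1\}^n\to\{0,1\}$ be a boolean function and $k$ a positive integer. If $M\subseteq[n]$ is such that the monomial $\prod_{i\in M}x_i$ has non-zero coefficient in the multilinear polynomial representing $f$, then the number of $i\in M$ with $\mathrm{sens}_i(f)\le k$ is at most $(k-1)^2$. The same conclusion holds for every $M\subseteq[n]$ with $\hat f(M)\ne0$.
   Context: $x^i$ is $x$ with bit $i$ flipped; $s_x(f)$ is the number of $j$ with $f(x)\ne f(x^j)$; $\mathrm{sens}_i(f):=\max_{x:f(x)\ne f(x^i)}(s_x(f)+s_{x^i}(f))$, and $\mathrm{sens}_i(f):=0$ if no such $x$ exists. Fourier coefficients: view $f$ as $F:\{\pm1\}^n\to\{\pm1\}$ via $0\mapsto1,1\mapsto-1$ on inputs and outputs, write $F(y)=\sum_{S\subseteq[n]}\hat f(S)\prod_{i\in S}y_i$; the $\hat f(S)$ are the Fourier coefficients. -}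

module Defs where

open import Data.Bool using (Bool; true; false; not; if_then_else_; _xor_)
open import Data.Nat using (ℕ; zero; suc; _⊔_; _+_)
open import Data.Fin using (Fin)
open import Data.Vec using (Vec; []; _∷_; updateAt; lookup)
open import Data.List using (List; []; _∷_; map; foldr; filter; _++_; allFin)
open import Data.Rational using (ℚ; 0ℚ; 1ℚ; -_)
import Data.Rational as Q
open import Relation.Binary.PropositionalEquality using (_≡_)

-- Boolean inputs x ∈ {0,1}^n are vectors of booleans (true = 1).
-- A subset of [n] is also encoded as Vec Bool n (characteristic vector),
-- exactly as Data.Fin.Subset does.
Input : ℕ → Set
Input n = Vec Bool n

allInputs : (n : ℕ) → List (Vec Bool n)
allInputs zero = [] ∷ []
allInputs (suc n) = map (false ∷_) (allInputs n) ++ map (true ∷_) (allInputs n)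

flipBit : ∀ {n} → Vec Bool n → Fin n → Vec Bool n
flipBit x i = updateAt x i not

b2n : Bool → ℕ
b2n true = 1
b2n false = 0

sensAt : ∀ {n} → (Vec Bool n → Bool) → Vec Bool n → ℕ
sensAt {n} f x = foldr _+_ 0 (map (λ j → b2n (f x xor f (flipBit x j))) (allFin n))

sens : ∀ {n} → (Vec Bool n → Bool) → Fin n → ℕ
sens {n} f i =
  foldr _⊔_ 0
    (map (λ x → sensAt f x + sensAt f (flipBit x i))
         (filter (λ x → Data.Bool._≟_ (f x xor f (flipBit x i)) true) (allInputs n)))
  where import Data.Bool

countLowSens : ∀ {n} → (Vec Bool n → Bool) → ℕ → Vec Bool n → ℕ
countLowSens {n} f k M =
  foldr _+_ 0 (map (λ i → if lookup M i then b2n (sens f i Data.Nat.≤ᵇ k) else 0) (allFin n))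
  where import Data.Nat

sumℚ : List ℚ → ℚ
sumℚ = foldr Q._+_ 0ℚ

bit : Bool → ℚ
bit true = 1ℚ
bit false = 0ℚ

pm : Bool → ℚ
pm true = - 1ℚ
pm false = 1ℚ

monomial : ∀ {n} → (Bool → ℚ) → Vec Bool n → Vec Bool n → ℚ
monomial v [] [] = 1ℚ
monomial v (s ∷ S) (b ∷ x) = (if s then v b else 1ℚ) Q.* monomial v S x

RepresentsML : ∀ {n} → (Vec Bool n → Bool) → (Vec Bool n → ℚ) → Set
RepresentsML {n} f c =
  ∀ (x : Vec Bool n) → bit (f x) ≡ sumℚ (map (λ S → c S Q.* monomial bit S x) (allInputs n))

FourierRep : ∀ {n} → (Vec Bool n → Bool) → (Vec Bool n → ℚ) → Set
FourierRep {n} f fh =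
  ∀ (x : Vec Bool n) → pm (f x) ≡ sumℚ (map (λ S → fh S Q.* monomial pm S x) (allInputs n))

module Submission where

-- Restrict f to the coordinates of M whose sensitivity is at most k, fixing the other coordinates so
-- that the top coefficient of the restriction h survives (for a Fourier coefficient, first pass from
-- the correlation with the character of M to such a restriction). Restricting does not increase
-- sensitivities, and a coordinate of sensitivity at most k forces every point to have sensitivity at
-- most k − 1. Since h has full degree, h ⊕ parity is unbalanced, so one of its level sets S contains
-- more than half of the cube; then there is a nonzero v with v and A v supported on S, where A is
-- Huang's signed adjacency matrix (A² = m I). Cauchy–Schwarz gives m ‖v‖² = ‖A v‖² ≤ d² ‖v‖², where d
-- bounds the degrees inside S, and these degrees are exactly the sensitivities of h.

open import Data.Bool using (Bool; true; false; not; _∧_; _xor_; T; if_then_else_)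
import Data.Bool.Properties as Bool
open import Data.Bool.Solver using (module xor-∧-Solver)
open import Data.Fin using (Fin; zero; suc)
open import Data.Fin.Subset using (∣_∣; _∩_) renaming (_∈_ to _∈ᵥ_)
open import Data.Fin.Subset.Properties using (p∩q⊆q; ∩-zeroˡ; ∣⊥∣≡0)
open import Data.List using (List; []; _∷_; _++_; length; map; foldr; filter; filterᵇ; allFin)
import Data.List.Properties as List
open import Data.List.Membership.Propositional using (_∈_)
open import Data.List.Membership.Propositional.Properties
  using (∈-map⁺; ∈-map⁻; ∈-++⁺ˡ; ∈-++⁺ʳ; ∈-filter⁺; ∈-filter⁻)
open import Data.List.Relation.Unary.All as All using (All; []; _∷_)
import Data.List.Relation.Unary.All.Properties as All
open import Data.List.Relation.Unary.AllPairs using ([]; _∷_)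
open import Data.List.Relation.Unary.Any using (here; there)
open import Data.List.Relation.Unary.Unique.Propositional using (Unique)
import Data.List.Relation.Unary.Unique.Propositional.Properties as Unique
open import Data.Nat as ℕ using (ℕ; zero; suc; _≤_; _<_; _∸_; _^_; z≤n; s≤s)
open import Data.Nat.ListAction using (sum)
import Data.Nat.Properties as ℕ
open import Data.Product as Product using (∃-syntax; _×_; _,_; proj₂; uncurry)
open import Data.Rational as ℚ
  using (ℚ; 0ℚ; 1ℚ; _+_; _*_; -_; _-_; positive; nonNegative; negative; nonPositive; 1/_; NonZero; ≢-nonZero)
open import Data.Rational.Properties
open import Data.Rational.Solver using (module +-*-Solver)
open import Data.Sum as Sum using (_⊎_; inj₁; inj₂)
open import Data.Vec using (Vec; []; _∷_; lookup; replicate; tabulate)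
import Data.Vec.Properties as Vec
open import Function using (id; _∘_; case_of_)
open import Relation.Binary using (Tri; tri<; tri≈; tri>)
open import Relation.Binary.Definitions using (DecidableEquality)
open import Relation.Binary.PropositionalEquality
open import Relation.Nullary using (¬_; Dec; yes; no; contradiction)
open import Relation.Nullary.Decidable using (T?)

open import Defs

open +-*-Solver using (solve; _:+_; _:*_; _:-_; :-_; _:=_; con)

toℚ : ℕ → ℚ
toℚ zero = 0ℚ
toℚ (suc n) = 1ℚ + toℚ n

toℚ-+ : ∀ a b → toℚ (a ℕ.+ b) ≡ toℚ a + toℚ b
toℚ-+ zero b = sym (+-identityˡ (toℚ b))
toℚ-+ (suc a) b = trans (cong (1ℚ +_) (toℚ-+ a b)) (sym (+-assoc 1ℚ (toℚ a) (toℚ b)))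

toℚ-* : ∀ a b → toℚ (a ℕ.* b) ≡ toℚ a * toℚ b
toℚ-* zero b = sym (*-zeroˡ (toℚ b))
toℚ-* (suc a) b = begin
  toℚ (b ℕ.+ a ℕ.* b)       ≡⟨ toℚ-+ b (a ℕ.* b) ⟩
  toℚ b + toℚ (a ℕ.* b)     ≡⟨ cong (toℚ b +_) (toℚ-* a b) ⟩
  toℚ b + toℚ a * toℚ b     ≡⟨ solve 2 (λ x y → y :+ x :* y := (con 1ℚ :+ x) :* y) refl (toℚ a) (toℚ b) ⟩
  (1ℚ + toℚ a) * toℚ b      ∎
  where open ≡-Reasoning

0≤1 : 0ℚ ℚ.≤ 1ℚ
0≤1 = nonNegative⁻¹ 1ℚ

0≤p⇒0≤q⇒0≤p+q : ∀ {p q} → 0ℚ ℚ.≤ p → 0ℚ ℚ.≤ q → 0ℚ ℚ.≤ p + q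
0≤p⇒0≤q⇒0≤p+q {p} {q} 0≤p 0≤q = subst (ℚ._≤ p + q) (+-identityʳ 0ℚ) (+-mono-≤ 0≤p 0≤q)

0≤p⇒0≤q⇒0≤p*q : ∀ {p q} → 0ℚ ℚ.≤ p → 0ℚ ℚ.≤ q → 0ℚ ℚ.≤ p * q
0≤p⇒0≤q⇒0≤p*q {p} {q} 0≤p 0≤q = nonNegative⁻¹ _ {{nonNeg*nonNeg⇒nonNeg p {{nonNegative 0≤p}} q {{nonNegative 0≤q}}}}

toℚ-nonNeg : ∀ n → 0ℚ ℚ.≤ toℚ n
toℚ-nonNeg zero = ≤-refl
toℚ-nonNeg (suc n) = 0≤p⇒0≤q⇒0≤p+q 0≤1 (toℚ-nonNeg n)

toℚ-mono-≤ : ∀ {a b} → a ≤ b → toℚ a ℚ.≤ toℚ b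
toℚ-mono-≤ {zero} {b} _ = toℚ-nonNeg b
toℚ-mono-≤ {suc a} {suc b} (s≤s a≤b) = +-monoʳ-≤ 1ℚ (toℚ-mono-≤ a≤b)

toℚ-mono-< : ∀ {a b} → a < b → toℚ a ℚ.< toℚ b
toℚ-mono-< {zero} {suc b} _ = subst (ℚ._< 1ℚ + toℚ b) (+-identityʳ 0ℚ) (+-mono-<-≤ (positive⁻¹ 1ℚ) (toℚ-nonNeg b))
toℚ-mono-< {suc a} {suc b} (s≤s a<b) = +-mono-≤-< (≤-refl {1ℚ}) (toℚ-mono-< a<b)

toℚ-cancel-≤ : ∀ {a b} → toℚ a ℚ.≤ toℚ b → a ≤ b
toℚ-cancel-≤ {a} {b} ≤ᵣ with a ℕ.≤? b
... | yes a≤b = a≤b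
... | no a≰b = contradiction (<-≤-trans (toℚ-mono-< (ℕ.≰⇒> a≰b)) ≤ᵣ) (<-irrefl refl)

p≤q⇒0≤q-p : ∀ {p q} → p ℚ.≤ q → 0ℚ ℚ.≤ q - p
p≤q⇒0≤q-p {p} {q} p≤q = subst (ℚ._≤ q - p) (+-inverseʳ p) (+-monoˡ-≤ (- p) p≤q)

0≤q-p⇒p≤q : ∀ {p q} → 0ℚ ℚ.≤ q - p → p ℚ.≤ q
0≤q-p⇒p≤q {p} {q} 0≤q-p =
  subst₂ ℚ._≤_ (+-identityʳ p) (solve 2 (λ p q → p :+ (q :- p) := q) refl p q) (+-monoʳ-≤ p 0≤q-p)

*-monoˡ-≤-0≤ : ∀ r {p q} → 0ℚ ℚ.≤ r → p ℚ.≤ q → r * p ℚ.≤ r * q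
*-monoˡ-≤-0≤ r 0≤r = *-monoˡ-≤-nonNeg r {{nonNegative 0≤r}}

*-monoʳ-≤-0≤ : ∀ r {p q} → 0ℚ ℚ.≤ r → p ℚ.≤ q → p * r ℚ.≤ q * r
*-monoʳ-≤-0≤ r 0≤r = *-monoʳ-≤-nonNeg r {{nonNegative 0≤r}}

*-distribʳ-minus : ∀ r p q → (p - q) * r ≡ p * r - q * r
*-distribʳ-minus = solve 3 (λ r p q → (p :- q) :* r := p :* r :- q :* r) refl

*-distribˡ-minus : ∀ r p q → r * (p - q) ≡ r * p - r * q
*-distribˡ-minus = solve 3 (λ r p q → r :* (p :- q) := r :* p :- r :* q) refl

+-interchange : ∀ a b c d → (a + b) + (c + d) ≡ (a + c) + (b + d)
+-interchange = solve 4 (λ a b c d → (a :+ b) :+ (c :+ d) := (a :+ c) :+ (b :+ d)) refl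

minus-+-interchange : ∀ a b c d → (a - b) + (c - d) ≡ (a + c) - (b + d)
minus-+-interchange = solve 4 (λ a b c d → (a :- b) :+ (c :- d) := (a :+ c) :- (b :+ d)) refl

+-minus-interchange : ∀ a b c d → (a + b) - (c + d) ≡ (a - c) + (b - d)
+-minus-interchange = solve 4 (λ a b c d → (a :+ b) :- (c :+ d) := (a :- c) :+ (b :- d)) refl

minus-minus-interchange : ∀ a b c d → (a - b) - (c - d) ≡ (a - c) - (b - d)
minus-minus-interchange = solve 4 (λ a b c d → (a :- b) :- (c :- d) := (a :- c) :- (b :- d)) refl

+-+minus-interchange : ∀ a b c d → (a + b) + (c - d) ≡ (a + c) + (b - d)
+-+minus-interchange = solve 4 (λ a b c d → (a :+ b) :+ (c :- d) := (a :+ c) :+ (b :- d)) refl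

*-swapˡ : ∀ p q r → p * (q * r) ≡ q * (p * r)
*-swapˡ = solve 3 (λ p q r → p :* (q :* r) := q :* (p :* r)) refl

p*q≡0⇒q≡0 : ∀ p q → p ≢ 0ℚ → p * q ≡ 0ℚ → q ≡ 0ℚ
p*q≡0⇒q≡0 p q p≢0 pq≡0 = begin
  q                ≡⟨ sym (*-identityˡ q) ⟩
  1ℚ * q           ≡⟨ cong (_* q) (sym (*-inverseˡ p)) ⟩
  1/ p * p * q     ≡⟨ *-assoc (1/ p) p q ⟩
  1/ p * (p * q)   ≡⟨ cong (1/ p *_) pq≡0 ⟩
  1/ p * 0ℚ        ≡⟨ *-zeroʳ (1/ p) ⟩
  0ℚ               ∎
  where open ≡-Reasoning
        instance _ = ≢-nonZero p≢0

square-nonNeg : ∀ p → 0ℚ ℚ.≤ p * p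
square-nonNeg p with ≤-total 0ℚ p
... | inj₁ 0≤p = nonNegative⁻¹ _ {{nonNeg*nonNeg⇒nonNeg p {{nonNegative 0≤p}} p {{nonNegative 0≤p}}}}
... | inj₂ p≤0 = nonNegative⁻¹ _ {{nonPos*nonPos⇒nonPos p {{nonPositive p≤0}} p {{nonPositive p≤0}}}}

square-pos : ∀ p → p ≢ 0ℚ → 0ℚ ℚ.< p * p
square-pos p p≢0 with <-cmp p 0ℚ
... | tri< p<0 _ _ = positive⁻¹ _ {{neg*neg⇒pos p {{negative p<0}} p {{negative p<0}}}}
... | tri≈ _ p≡0 _ = contradiction p≡0 p≢0
... | tri> _ _ 0<p = positive⁻¹ _ {{pos*pos⇒pos p {{positive 0<p}} p {{positive 0<p}}}}

square≤0⇒≡0 : ∀ p → p * p ℚ.≤ 0ℚ → p ≡ 0ℚ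
square≤0⇒≡0 p p²≤0 with p ≟ 0ℚ
... | yes p≡0 = p≡0
... | no p≢0 = contradiction (<-≤-trans (square-pos p p≢0) p²≤0) (<-irrefl refl)

p+q≢0⇒p≢0⊎q≢0 : ∀ p q → p + q ≢ 0ℚ → p ≢ 0ℚ ⊎ q ≢ 0ℚ
p+q≢0⇒p≢0⊎q≢0 p q p+q≢0 with p ≟ 0ℚ | q ≟ 0ℚ
... | no p≢0 | _ = inj₁ p≢0
... | yes _ | no q≢0 = inj₂ q≢0
... | yes refl | yes refl = contradiction refl p+q≢0

p-q≢0⇒p≢0⊎q≢0 : ∀ p q → p - q ≢ 0ℚ → p ≢ 0ℚ ⊎ q ≢ 0ℚ
p-q≢0⇒p≢0⊎q≢0 p q = Sum.map₂ (λ -q≢0 q≡0 → -q≢0 (cong (λ r → - r) q≡0)) ∘ p+q≢0⇒p≢0⊎q≢0 p (- q)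

p-q≡0⇒q-p≡0 : ∀ {p q} → p - q ≡ 0ℚ → q - p ≡ 0ℚ
p-q≡0⇒q-p≡0 {p} {q} p-q≡0 = trans (solve 2 (λ p q → q :- p := :- (p :- q)) refl p q) (cong (λ r → - r) p-q≡0)

-- For n > 0 this is Cauchy–Schwarz with weights (1, n):
-- n ((1 + n)(b² + T) − (a + b)²) = (n b − a)² + (1 + n)(n T − a²).
cauchy-schwarz-step : ∀ a b n T → 0ℚ ℚ.≤ n → 0ℚ ℚ.≤ T → a * a ℚ.≤ n * T →
                      (a + b) * (a + b) ℚ.≤ (1ℚ + n) * (b * b + T)
cauchy-schwarz-step a b n T 0≤n 0≤T a²≤nT with <-cmp 0ℚ n
... | tri> _ _ n<0 = contradiction (<-≤-trans n<0 0≤n) (<-irrefl refl)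
... | tri≈ _ refl _ = begin
  (a + b) * (a + b)        ≡⟨ cong (λ a → (a + b) * (a + b)) a≡0 ⟩
  (0ℚ + b) * (0ℚ + b)      ≡⟨ solve 1 (λ b → (con 0ℚ :+ b) :* (con 0ℚ :+ b) := b :* b :+ con 0ℚ) refl b ⟩
  b * b + 0ℚ               ≤⟨ +-monoʳ-≤ (b * b) 0≤T ⟩
  b * b + T                ≡⟨ sym (*-identityˡ (b * b + T)) ⟩
  (1ℚ + 0ℚ) * (b * b + T)  ∎
  where open ≤-Reasoning
        a≡0 : a ≡ 0ℚ
        a≡0 = square≤0⇒≡0 a (subst (a * a ℚ.≤_) (*-zeroˡ T) a²≤nT)
... | tri< 0<n _ _ = 0≤q-p⇒p≤q (*-cancelˡ-≤-pos n {{positive 0<n}} n*0≤n*gap)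
  where
    gap = (1ℚ + n) * (b * b + T) - (a + b) * (a + b)
    identity : n * gap ≡ (n * b - a) * (n * b - a) + (1ℚ + n) * (n * T - a * a)
    identity = solve 4 (λ a b n T →
      n :* ((con 1ℚ :+ n) :* (b :* b :+ T) :- (a :+ b) :* (a :+ b))
        := (n :* b :- a) :* (n :* b :- a) :+ (con 1ℚ :+ n) :* (n :* T :- a :* a)) refl a b n T
    n*0≤n*gap : n * 0ℚ ℚ.≤ n * gap
    n*0≤n*gap = subst₂ ℚ._≤_ (sym (*-zeroʳ n)) (sym identity)
      (0≤p⇒0≤q⇒0≤p+q (square-nonNeg (n * b - a))
        (0≤p⇒0≤q⇒0≤p*q (0≤p⇒0≤q⇒0≤p+q 0≤1 0≤n) (p≤q⇒0≤q-p a²≤nT)))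

-- Functions on the Boolean cube

Fun : ℕ → Set
Fun m = Vec Bool m → ℚ

∑ : ∀ {m} → Fun m → ℚ
∑ {zero} g = g []
∑ {suc m} g = ∑ (λ x → g (false ∷ x)) + ∑ (λ x → g (true ∷ x))

∑-cong : ∀ {m} {g h : Fun m} → (∀ x → g x ≡ h x) → ∑ g ≡ ∑ h
∑-cong {zero} g≗h = g≗h []
∑-cong {suc m} g≗h = cong₂ _+_ (∑-cong (λ x → g≗h (false ∷ x))) (∑-cong (λ x → g≗h (true ∷ x)))

∑-+ : ∀ {m} (g h : Fun m) → ∑ (λ x → g x + h x) ≡ ∑ g + ∑ h
∑-+ {zero} g h = refl
∑-+ {suc m} g h = trans (cong₂ _+_ (∑-+ g₀ h₀) (∑-+ g₁ h₁)) (+-interchange (∑ g₀) (∑ h₀) (∑ g₁) (∑ h₁))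
  where g₀ = λ x → g (false ∷ x) ; g₁ = λ x → g (true ∷ x)
        h₀ = λ x → h (false ∷ x) ; h₁ = λ x → h (true ∷ x)

∑-minus : ∀ {m} (g h : Fun m) → ∑ (λ x → g x - h x) ≡ ∑ g - ∑ h
∑-minus {zero} g h = refl
∑-minus {suc m} g h = trans (cong₂ _+_ (∑-minus g₀ h₀) (∑-minus g₁ h₁)) (minus-+-interchange (∑ g₀) (∑ h₀) (∑ g₁) (∑ h₁))
  where g₀ = λ x → g (false ∷ x) ; g₁ = λ x → g (true ∷ x)
        h₀ = λ x → h (false ∷ x) ; h₁ = λ x → h (true ∷ x)

∑-* : ∀ {m} c (g : Fun m) → ∑ (λ x → c * g x) ≡ c * ∑ g
∑-* {zero} c g = refl
∑-* {suc m} c g = trans (cong₂ _+_ (∑-* c g₀) (∑-* c g₁)) (sym (*-distribˡ-+ c (∑ g₀) (∑ g₁)))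
  where g₀ = λ x → g (false ∷ x) ; g₁ = λ x → g (true ∷ x)

∑-0 : ∀ {m} → ∑ {m} (λ _ → 0ℚ) ≡ 0ℚ
∑-0 {zero} = refl
∑-0 {suc m} = trans (cong₂ _+_ (∑-0 {m}) (∑-0 {m})) (+-identityʳ 0ℚ)

∑-mono-≤ : ∀ {m} {g h : Fun m} → (∀ x → g x ℚ.≤ h x) → ∑ g ℚ.≤ ∑ h
∑-mono-≤ {zero} g≤h = g≤h []
∑-mono-≤ {suc m} g≤h = +-mono-≤ (∑-mono-≤ (λ x → g≤h (false ∷ x))) (∑-mono-≤ (λ x → g≤h (true ∷ x)))

∑-nonNeg : ∀ {m} {g : Fun m} → (∀ x → 0ℚ ℚ.≤ g x) → 0ℚ ℚ.≤ ∑ g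
∑-nonNeg {m} {g} 0≤g = subst (ℚ._≤ ∑ g) (∑-0 {m}) (∑-mono-≤ 0≤g)

∑-nonNeg-≥ : ∀ {m} {g : Fun m} → (∀ x → 0ℚ ℚ.≤ g x) → ∀ x → g x ℚ.≤ ∑ g
∑-nonNeg-≥ {zero} 0≤g [] = ≤-refl
∑-nonNeg-≥ {suc m} {g} 0≤g (false ∷ x) = subst (ℚ._≤ ∑ g) (+-identityʳ (g (false ∷ x)))
  (+-mono-≤ (∑-nonNeg-≥ (λ y → 0≤g (false ∷ y)) x) (∑-nonNeg (λ y → 0≤g (true ∷ y))))
∑-nonNeg-≥ {suc m} {g} 0≤g (true ∷ x) = subst (ℚ._≤ ∑ g) (+-identityˡ (g (true ∷ x)))
  (+-mono-≤ (∑-nonNeg (λ y → 0≤g (false ∷ y))) (∑-nonNeg-≥ (λ y → 0≤g (true ∷ y)) x))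

δ : ∀ {m} → Vec Bool m → Vec Bool m → ℚ
δ [] [] = 1ℚ
δ (false ∷ x) (false ∷ y) = δ x y
δ (true ∷ x) (true ∷ y) = δ x y
δ (false ∷ x) (true ∷ y) = 0ℚ
δ (true ∷ x) (false ∷ y) = 0ℚ

∑-0* : ∀ {m} (w : Fun m) → ∑ (λ y → 0ℚ * w y) ≡ 0ℚ
∑-0* {m} w = trans (∑-cong (λ y → *-zeroˡ (w y))) (∑-0 {m})

∑-δ : ∀ {m} (x : Vec Bool m) (w : Fun m) → ∑ (λ y → δ x y * w y) ≡ w x
∑-δ [] w = *-identityˡ (w [])
∑-δ (false ∷ x) w =
  trans (cong₂ _+_ (∑-δ x (λ y → w (false ∷ y))) (∑-0* (λ y → w (true ∷ y)))) (+-identityʳ (w (false ∷ x)))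
∑-δ (true ∷ x) w =
  trans (cong₂ _+_ (∑-0* (λ y → w (false ∷ y))) (∑-δ x (λ y → w (true ∷ y)))) (+-identityˡ (w (true ∷ x)))

⟨_,_⟩ : ∀ {m} → Fun m → Fun m → ℚ
⟨ v , w ⟩ = ∑ (λ x → v x * w x)

sumℚ-++ : ∀ xs ys → sumℚ (xs ++ ys) ≡ sumℚ xs + sumℚ ys
sumℚ-++ [] ys = sym (+-identityˡ (sumℚ ys))
sumℚ-++ (x ∷ xs) ys = trans (cong (x +_) (sumℚ-++ xs ys)) (sym (+-assoc x (sumℚ xs) (sumℚ ys)))

sumℚ-allInputs : ∀ {m} (g : Fun m) → sumℚ (map g (allInputs m)) ≡ ∑ g
sumℚ-allInputs {zero} g = +-identityʳ (g [])
sumℚ-allInputs {suc m} g = begin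
  sumℚ (map g (map (false ∷_) I ++ map (true ∷_) I))
    ≡⟨ cong sumℚ (List.map-++ g (map (false ∷_) I) (map (true ∷_) I)) ⟩
  sumℚ (map g (map (false ∷_) I) ++ map g (map (true ∷_) I))
    ≡⟨ sumℚ-++ (map g (map (false ∷_) I)) (map g (map (true ∷_) I)) ⟩
  sumℚ (map g (map (false ∷_) I)) + sumℚ (map g (map (true ∷_) I))
    ≡⟨ sym (cong₂ (λ p q → sumℚ p + sumℚ q) (List.map-∘ I) (List.map-∘ I)) ⟩
  sumℚ (map g₀ I) + sumℚ (map g₁ I)
    ≡⟨ cong₂ _+_ (sumℚ-allInputs g₀) (sumℚ-allInputs g₁) ⟩
  ∑ g ∎
  where open ≡-Reasoning
        I = allInputs m
        g₀ = λ x → g (false ∷ x)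
        g₁ = λ x → g (true ∷ x)

allInputs-complete : ∀ {m} (x : Vec Bool m) → x ∈ allInputs m
allInputs-complete [] = here refl
allInputs-complete {suc m} (false ∷ x) = ∈-++⁺ˡ (∈-map⁺ (false ∷_) (allInputs-complete x))
allInputs-complete {suc m} (true ∷ x) = ∈-++⁺ʳ (map (false ∷_) (allInputs m)) (∈-map⁺ (true ∷_) (allInputs-complete x))

allInputs-unique : ∀ m → Unique (allInputs m)
allInputs-unique zero = [] ∷ []
allInputs-unique (suc m) =
  Unique.++⁺ (Unique.map⁺ Vec.∷-injectiveʳ (allInputs-unique m)) (Unique.map⁺ Vec.∷-injectiveʳ (allInputs-unique m)) disjoint
  where
    disjoint : ∀ {x} → ¬ (x ∈ map (false ∷_) (allInputs m) × x ∈ map (true ∷_) (allInputs m))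
    disjoint (x∈₀ , x∈₁) with ∈-map⁻ (false ∷_) x∈₀ | ∈-map⁻ (true ∷_) x∈₁
    ... | _ , _ , refl | _ , _ , ()

record IsLinear {m} (Φ : Fun m → ℚ) : Set where
  field
    Φ-cong : ∀ {g h} → (∀ x → g x ≡ h x) → Φ g ≡ Φ h
    Φ-+ : ∀ g h → Φ (λ x → g x + h x) ≡ Φ g + Φ h
    Φ-* : ∀ c g → Φ (λ x → c * g x) ≡ c * Φ g

  Φ-minus : ∀ g h → Φ (λ x → g x - h x) ≡ Φ g - Φ h
  Φ-minus g h = begin
    Φ (λ x → g x - h x)          ≡⟨ Φ-cong (λ x → minus≡+-1* (g x) (h x)) ⟩
    Φ (λ x → g x + - 1ℚ * h x)   ≡⟨ Φ-+ g (λ x → - 1ℚ * h x) ⟩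
    Φ g + Φ (λ x → - 1ℚ * h x)   ≡⟨ cong (Φ g +_) (Φ-* (- 1ℚ) h) ⟩
    Φ g + - 1ℚ * Φ h             ≡⟨ sym (minus≡+-1* (Φ g) (Φ h)) ⟩
    Φ g - Φ h                    ∎
    where open ≡-Reasoning
          minus≡+-1* : ∀ p q → p - q ≡ p + - 1ℚ * q
          minus≡+-1* = solve 2 (λ p q → p :- q := p :+ (:- con 1ℚ) :* q) refl

  Φ-sumℚ : ∀ {S : Set} (c : S → ℚ) (F : S → Fun m) Ss →
           Φ (λ x → sumℚ (map (λ s → c s * F s x) Ss)) ≡ sumℚ (map (λ s → c s * Φ (F s)) Ss)
  Φ-sumℚ c F [] = trans (Φ-cong (λ x → sym (*-zeroˡ 0ℚ))) (trans (Φ-* 0ℚ (λ _ → 0ℚ)) (*-zeroˡ (Φ (λ _ → 0ℚ))))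
  Φ-sumℚ c F (s ∷ Ss) = trans (Φ-+ (λ x → c s * F s x) _) (cong₂ _+_ (Φ-* (c s) (F s)) (Φ-sumℚ c F Ss))

-- Huang's signed adjacency matrix

-- A₀ = 0 and A_{m+1} = [[A_m, I], [I, −A_m]], the blocks being indexed by the first coordinate.
A : ∀ {m} → Fun m → Fun m
A {zero} v x = 0ℚ
A {suc m} v (false ∷ x) = A (λ y → v (false ∷ y)) x + v (true ∷ x)
A {suc m} v (true ∷ x) = v (false ∷ x) - A (λ y → v (true ∷ y)) x

A-+ : ∀ {m} (v w : Fun m) x → A (λ y → v y + w y) x ≡ A v x + A w x
A-+ {zero} v w x = sym (+-identityʳ 0ℚ)
A-+ {suc m} v w (false ∷ x) =
  trans (cong (_+ (v (true ∷ x) + w (true ∷ x))) (A-+ v₀ w₀ x))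
        (+-interchange (A v₀ x) (A w₀ x) (v (true ∷ x)) (w (true ∷ x)))
  where v₀ = λ y → v (false ∷ y)
        w₀ = λ y → w (false ∷ y)
A-+ {suc m} v w (true ∷ x) =
  trans (cong (λ z → (v (false ∷ x) + w (false ∷ x)) - z) (A-+ v₁ w₁ x))
        (+-minus-interchange (v (false ∷ x)) (w (false ∷ x)) (A v₁ x) (A w₁ x))
  where v₁ = λ y → v (true ∷ y)
        w₁ = λ y → w (true ∷ y)

A-minus : ∀ {m} (v w : Fun m) x → A (λ y → v y - w y) x ≡ A v x - A w x
A-minus {zero} v w x = sym (+-inverseʳ 0ℚ)
A-minus {suc m} v w (false ∷ x) =
  trans (cong (_+ (v (true ∷ x) - w (true ∷ x))) (A-minus v₀ w₀ x))
        (minus-+-interchange (A v₀ x) (A w₀ x) (v (true ∷ x)) (w (true ∷ x)))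
  where v₀ = λ y → v (false ∷ y)
        w₀ = λ y → w (false ∷ y)
A-minus {suc m} v w (true ∷ x) =
  trans (cong (λ z → (v (false ∷ x) - w (false ∷ x)) - z) (A-minus v₁ w₁ x))
        (minus-minus-interchange (v (false ∷ x)) (w (false ∷ x)) (A v₁ x) (A w₁ x))
  where v₁ = λ y → v (true ∷ y)
        w₁ = λ y → w (true ∷ y)

A∘A : ∀ {m} (v : Fun m) x → A (A v) x ≡ toℚ m * v x
A∘A {zero} v x = sym (*-zeroˡ (v x))
A∘A {suc m} v (false ∷ x) = begin
  A (λ y → A v₀ y + v₁ y) x + (v₀ x - A v₁ x)     ≡⟨ cong (_+ (v₀ x - A v₁ x)) (A-+ (A v₀) v₁ x) ⟩
  (A (A v₀) x + A v₁ x) + (v₀ x - A v₁ x)         ≡⟨ cong (λ z → (z + A v₁ x) + (v₀ x - A v₁ x)) (A∘A v₀ x) ⟩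
  (toℚ m * v₀ x + A v₁ x) + (v₀ x - A v₁ x)
    ≡⟨ solve 3 (λ n a c → (n :* a :+ c) :+ (a :- c) := (con 1ℚ :+ n) :* a) refl (toℚ m) (v₀ x) (A v₁ x) ⟩
  (1ℚ + toℚ m) * v₀ x                             ∎
  where open ≡-Reasoning
        v₀ = λ y → v (false ∷ y)
        v₁ = λ y → v (true ∷ y)
A∘A {suc m} v (true ∷ x) = begin
  (A v₀ x + v₁ x) - A (λ y → v₀ y - A v₁ y) x     ≡⟨ cong (λ z → (A v₀ x + v₁ x) - z) (A-minus v₀ (A v₁) x) ⟩
  (A v₀ x + v₁ x) - (A v₀ x - A (A v₁) x)         ≡⟨ cong (λ z → (A v₀ x + v₁ x) - (A v₀ x - z)) (A∘A v₁ x) ⟩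
  (A v₀ x + v₁ x) - (A v₀ x - toℚ m * v₁ x)
    ≡⟨ solve 3 (λ n a c → (c :+ a) :- (c :- n :* a) := (con 1ℚ :+ n) :* a) refl (toℚ m) (v₁ x) (A v₀ x) ⟩
  (1ℚ + toℚ m) * v₁ x                             ∎
  where open ≡-Reasoning
        v₀ = λ y → v (false ∷ y)
        v₁ = λ y → v (true ∷ y)

A-selfAdjoint : ∀ {m} (v w : Fun m) → ⟨ A v , w ⟩ ≡ ⟨ v , A w ⟩
A-selfAdjoint {zero} v w = trans (*-zeroˡ (w [])) (sym (*-zeroʳ (v [])))
A-selfAdjoint {suc m} v w = begin
  ∑ (λ x → (A v₀ x + v₁ x) * w₀ x) + ∑ (λ x → (v₀ x - A v₁ x) * w₁ x)
    ≡⟨ cong₂ _+_ (trans (∑-cong (λ x → *-distribʳ-+ (w₀ x) (A v₀ x) (v₁ x))) (∑-+ {m} _ _))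
                 (trans (∑-cong (λ x → *-distribʳ-minus (w₁ x) (v₀ x) (A v₁ x))) (∑-minus {m} _ _)) ⟩
  (⟨ A v₀ , w₀ ⟩ + ⟨ v₁ , w₀ ⟩) + (⟨ v₀ , w₁ ⟩ - ⟨ A v₁ , w₁ ⟩)
    ≡⟨ cong₂ (λ p q → (p + ⟨ v₁ , w₀ ⟩) + (⟨ v₀ , w₁ ⟩ - q)) (A-selfAdjoint v₀ w₀) (A-selfAdjoint v₁ w₁) ⟩
  (⟨ v₀ , A w₀ ⟩ + ⟨ v₁ , w₀ ⟩) + (⟨ v₀ , w₁ ⟩ - ⟨ v₁ , A w₁ ⟩)
    ≡⟨ +-+minus-interchange ⟨ v₀ , A w₀ ⟩ ⟨ v₁ , w₀ ⟩ ⟨ v₀ , w₁ ⟩ ⟨ v₁ , A w₁ ⟩ ⟩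
  (⟨ v₀ , A w₀ ⟩ + ⟨ v₀ , w₁ ⟩) + (⟨ v₁ , w₀ ⟩ - ⟨ v₁ , A w₁ ⟩)
    ≡⟨ sym (cong₂ _+_ (trans (∑-cong (λ x → *-distribˡ-+ (v₀ x) (A w₀ x) (w₁ x))) (∑-+ {m} _ _))
                      (trans (∑-cong (λ x → *-distribˡ-minus (v₁ x) (w₀ x) (A w₁ x))) (∑-minus {m} _ _))) ⟩
  ∑ (λ x → v₀ x * (A w₀ x + w₁ x)) + ∑ (λ x → v₁ x * (w₀ x - A w₁ x))
    ∎
  where open ≡-Reasoning
        v₀ = λ y → v (false ∷ y)
        v₁ = λ y → v (true ∷ y)
        w₀ = λ y → w (false ∷ y)
        w₁ = λ y → w (true ∷ y)

‖Av‖²≡m‖v‖² : ∀ {m} (v : Fun m) → ⟨ A v , A v ⟩ ≡ toℚ m * ⟨ v , v ⟩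
‖Av‖²≡m‖v‖² {m} v = begin
  ⟨ A v , A v ⟩               ≡⟨ A-selfAdjoint v (A v) ⟩
  ∑ (λ x → v x * A (A v) x)   ≡⟨ ∑-cong (λ x → cong (v x *_) (A∘A v x)) ⟩
  ∑ (λ x → v x * (toℚ m * v x)) ≡⟨ ∑-cong (λ x → solve 2 (λ n a → a :* (n :* a) := n :* (a :* a)) refl (toℚ m) (v x)) ⟩
  ∑ (λ x → toℚ m * (v x * v x)) ≡⟨ ∑-* (toℚ m) (λ x → v x * v x) ⟩
  toℚ m * ⟨ v , v ⟩           ∎
  where open ≡-Reasoning

-- Degrees inside a subset of the cube

degreeIn : ∀ {m} → (Vec Bool m → Bool) → Vec Bool m → ℕ
degreeIn {zero} S [] = 0
degreeIn {suc m} S (b ∷ x) = b2n (S (not b ∷ x)) ℕ.+ degreeIn (λ y → S (b ∷ y)) x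

neighbourSqSum : ∀ {m} → Fun m → Vec Bool m → ℚ
neighbourSqSum {zero} v [] = 0ℚ
neighbourSqSum {suc m} v (b ∷ x) = v (not b ∷ x) * v (not b ∷ x) + neighbourSqSum (λ y → v (b ∷ y)) x

neighbourSqSum-nonNeg : ∀ {m} (v : Fun m) x → 0ℚ ℚ.≤ neighbourSqSum v x
neighbourSqSum-nonNeg {zero} v [] = ≤-refl
neighbourSqSum-nonNeg {suc m} v (b ∷ x) =
  0≤p⇒0≤q⇒0≤p+q (square-nonNeg (v (not b ∷ x))) (neighbourSqSum-nonNeg (λ y → v (b ∷ y)) x)

SupportedOn : ∀ {m} → (Vec Bool m → Bool) → Fun m → Set
SupportedOn S v = ∀ x → S x ≡ false → v x ≡ 0ℚ

neighbour-step : ∀ s a b d T → 0ℚ ℚ.≤ T → (s ≡ false → b ≡ 0ℚ) → a * a ℚ.≤ toℚ d * T →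
                 (a + b) * (a + b) ℚ.≤ toℚ (b2n s ℕ.+ d) * (b * b + T)
neighbour-step true a b d T 0≤T _ = cauchy-schwarz-step a b (toℚ d) T (toℚ-nonNeg d) 0≤T
neighbour-step false a b d T _ b≡0 a²≤dT rewrite b≡0 refl =
  subst₂ ℚ._≤_ (cong (λ z → z * z) (sym (+-identityʳ a))) (cong (toℚ d *_) (sym (+-identityˡ T))) a²≤dT

neighbour-step-sub : ∀ s a b d T → 0ℚ ℚ.≤ T → (s ≡ false → b ≡ 0ℚ) → a * a ℚ.≤ toℚ d * T →
                     (b - a) * (b - a) ℚ.≤ toℚ (b2n s ℕ.+ d) * (b * b + T)
neighbour-step-sub s a b d T 0≤T b≡0 a²≤dT =
  subst (ℚ._≤ toℚ (b2n s ℕ.+ d) * (b * b + T))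
        (solve 2 (λ a b → (:- a :+ b) :* (:- a :+ b) := (b :- a) :* (b :- a)) refl a b)
        (neighbour-step s (- a) b d T 0≤T b≡0
          (subst (ℚ._≤ toℚ d * T) (solve 1 (λ a → a :* a := (:- a) :* (:- a)) refl a) a²≤dT))

A-square≤degree*neighbourSqSum : ∀ {m} (S : Vec Bool m → Bool) (v : Fun m) → SupportedOn S v →
  ∀ x → A v x * A v x ℚ.≤ toℚ (degreeIn S x) * neighbourSqSum v x
A-square≤degree*neighbourSqSum {zero} S v _ [] = ≤-refl
A-square≤degree*neighbourSqSum {suc m} S v supp (false ∷ x) =
  neighbour-step (S (true ∷ x)) (A v₀ x) (v (true ∷ x)) (degreeIn S₀ x) (neighbourSqSum v₀ x)
    (neighbourSqSum-nonNeg v₀ x) (supp (true ∷ x))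
    (A-square≤degree*neighbourSqSum S₀ v₀ (λ y → supp (false ∷ y)) x)
  where S₀ = λ y → S (false ∷ y)
        v₀ = λ y → v (false ∷ y)
A-square≤degree*neighbourSqSum {suc m} S v supp (true ∷ x) =
  neighbour-step-sub (S (false ∷ x)) (A v₁ x) (v (false ∷ x)) (degreeIn S₁ x) (neighbourSqSum v₁ x)
    (neighbourSqSum-nonNeg v₁ x) (supp (false ∷ x))
    (A-square≤degree*neighbourSqSum S₁ v₁ (λ y → supp (true ∷ y)) x)
  where S₁ = λ y → S (true ∷ y)
        v₁ = λ y → v (true ∷ y)

toℚ-b2n-+ : ∀ s d → toℚ (b2n s ℕ.+ d) ≡ bit s + toℚ d
toℚ-b2n-+ true d = refl
toℚ-b2n-+ false d = sym (+-identityˡ (toℚ d))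

double-counting : ∀ {m} (S : Vec Bool m → Bool) (v : Fun m) →
  ∑ (λ x → bit (S x) * neighbourSqSum v x) ≡ ∑ (λ x → toℚ (degreeIn S x) * (v x * v x))
double-counting {zero} S v = trans (*-zeroʳ (bit (S []))) (sym (*-zeroˡ (v [] * v [])))
double-counting {suc m} S v = begin
  ∑ (λ x → bit (S₀ x) * (v₁ x * v₁ x + neighbourSqSum v₀ x))
    + ∑ (λ x → bit (S₁ x) * (v₀ x * v₀ x + neighbourSqSum v₁ x))
    ≡⟨ cong₂ _+_ (trans (∑-cong (λ x → *-distribˡ-+ (bit (S₀ x)) _ _)) (∑-+ {m} _ _))
                 (trans (∑-cong (λ x → *-distribˡ-+ (bit (S₁ x)) _ _)) (∑-+ {m} _ _)) ⟩
  (P₀ + ∑ (λ x → bit (S₀ x) * neighbourSqSum v₀ x)) + (P₁ + ∑ (λ x → bit (S₁ x) * neighbourSqSum v₁ x))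
    ≡⟨ cong₂ (λ p q → (P₀ + p) + (P₁ + q)) (double-counting S₀ v₀) (double-counting S₁ v₁) ⟩
  (P₀ + Q₀) + (P₁ + Q₁)
    ≡⟨ solve 4 (λ a b c d → (a :+ b) :+ (c :+ d) := (c :+ b) :+ (a :+ d)) refl P₀ Q₀ P₁ Q₁ ⟩
  (P₁ + Q₀) + (P₀ + Q₁)
    ≡⟨ sym (cong₂ _+_ (trans (∑-cong (λ x → trans (cong (_* (v₀ x * v₀ x)) (toℚ-b2n-+ (S₁ x) _))
                                                  (*-distribʳ-+ (v₀ x * v₀ x) (bit (S₁ x)) _)))
                             (∑-+ {m} _ _))
                      (trans (∑-cong (λ x → trans (cong (_* (v₁ x * v₁ x)) (toℚ-b2n-+ (S₀ x) _))
                                                  (*-distribʳ-+ (v₁ x * v₁ x) (bit (S₀ x)) _)))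
                             (∑-+ {m} _ _))) ⟩
  ∑ (λ x → toℚ (b2n (S₁ x) ℕ.+ degreeIn S₀ x) * (v₀ x * v₀ x))
    + ∑ (λ x → toℚ (b2n (S₀ x) ℕ.+ degreeIn S₁ x) * (v₁ x * v₁ x))
    ∎
  where open ≡-Reasoning
        S₀ = λ y → S (false ∷ y)
        S₁ = λ y → S (true ∷ y)
        v₀ = λ y → v (false ∷ y)
        v₁ = λ y → v (true ∷ y)
        P₀ = ∑ (λ x → bit (S₀ x) * (v₁ x * v₁ x))
        P₁ = ∑ (λ x → bit (S₁ x) * (v₀ x * v₀ x))
        Q₀ = ∑ (λ x → toℚ (degreeIn S₀ x) * (v₀ x * v₀ x))
        Q₁ = ∑ (λ x → toℚ (degreeIn S₁ x) * (v₁ x * v₁ x))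

A-supported⇒m≤d*d : ∀ {m} d (S : Vec Bool m → Bool) (v : Fun m) → SupportedOn S v → SupportedOn S (A v) →
  (∀ x → S x ≡ true → degreeIn S x ≤ d) → ∀ x₀ → v x₀ ≢ 0ℚ → m ≤ d ℕ.* d
A-supported⇒m≤d*d {m} d S v supp suppA deg≤d x₀ v≢0 =
  toℚ-cancel-≤ (subst (toℚ m ℚ.≤_) (sym (toℚ-* d d))
    (*-cancelʳ-≤-pos ‖v‖² {{positive 0<‖v‖²}} m‖v‖²≤D²‖v‖²))
  where
    D = toℚ d
    ‖v‖² = ⟨ v , v ⟩
    0<‖v‖² : 0ℚ ℚ.< ‖v‖²
    0<‖v‖² = <-≤-trans (square-pos (v x₀) v≢0) (∑-nonNeg-≥ (λ x → square-nonNeg (v x)) x₀)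
    toℚ-degree≤D : ∀ x → S x ≡ true → toℚ (degreeIn S x) ℚ.≤ D
    toℚ-degree≤D x Sx = toℚ-mono-≤ (deg≤d x Sx)
    pointwise : ∀ x → A v x * A v x ℚ.≤ D * (bit (S x) * neighbourSqSum v x)
    pointwise x with S x in Sx
    ... | true = ≤-trans (A-square≤degree*neighbourSqSum S v supp x)
                   (subst (toℚ (degreeIn S x) * neighbourSqSum v x ℚ.≤_) (cong (D *_) (sym (*-identityˡ _)))
                     (*-monoʳ-≤-0≤ (neighbourSqSum v x) (neighbourSqSum-nonNeg v x) (toℚ-degree≤D x Sx)))
    ... | false = subst₂ ℚ._≤_ (cong (λ z → z * z) (sym (suppA x Sx)))
                    (sym (trans (cong (D *_) (*-zeroˡ (neighbourSqSum v x))) (*-zeroʳ D))) ≤-refl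
    weighted : ∀ x → toℚ (degreeIn S x) * (v x * v x) ℚ.≤ D * (v x * v x)
    weighted x with S x in Sx
    ... | true = *-monoʳ-≤-0≤ (v x * v x) (square-nonNeg (v x)) (toℚ-degree≤D x Sx)
    ... | false rewrite supp x Sx = subst₂ ℚ._≤_ (sym (*-zeroʳ (toℚ (degreeIn S x)))) (sym (*-zeroʳ D)) ≤-refl
    m‖v‖²≤D²‖v‖² : toℚ m * ‖v‖² ℚ.≤ (D * D) * ‖v‖²
    m‖v‖²≤D²‖v‖² = begin
      toℚ m * ‖v‖²                                        ≡⟨ sym (‖Av‖²≡m‖v‖² v) ⟩
      ⟨ A v , A v ⟩                                        ≤⟨ ∑-mono-≤ pointwise ⟩
      ∑ (λ x → D * (bit (S x) * neighbourSqSum v x))       ≡⟨ ∑-* {m} D _ ⟩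
      D * ∑ (λ x → bit (S x) * neighbourSqSum v x)         ≡⟨ cong (D *_) (double-counting S v) ⟩
      D * ∑ (λ x → toℚ (degreeIn S x) * (v x * v x))       ≤⟨ *-monoˡ-≤-0≤ D (toℚ-nonNeg d) (∑-mono-≤ weighted) ⟩
      D * ∑ (λ x → D * (v x * v x))                        ≡⟨ cong (D *_) (∑-* {m} D _) ⟩
      D * (D * ‖v‖²)                                       ≡⟨ sym (*-assoc D D ‖v‖²) ⟩
      (D * D) * ‖v‖²                                       ∎
      where open ≤-Reasoning

-- Homogeneous linear systems

module LinearAlgebra {X : Set} (_≟ₓ_ : DecidableEquality X) where

  dot : List X → (X → ℚ) → (X → ℚ) → ℚ
  dot xs ℓ u = sumℚ (map (λ x → ℓ x * u x) xs)

  dot-minus-* : ∀ xs (ℓ ℓ′ u : X → ℚ) r → dot xs (λ x → ℓ x - r * ℓ′ x) u ≡ dot xs ℓ u - r * dot xs ℓ′ u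
  dot-minus-* [] ℓ ℓ′ u r = solve 1 (λ r → con 0ℚ := con 0ℚ :- r :* con 0ℚ) refl r
  dot-minus-* (x ∷ xs) ℓ ℓ′ u r = trans (cong ((ℓ x - r * ℓ′ x) * u x +_) (dot-minus-* xs ℓ ℓ′ u r))
    (solve 6 (λ a b c r d e → (a :- r :* b) :* c :+ (d :- r :* e) := (a :* c :+ d) :- r :* (b :* c :+ e)) refl
      (ℓ x) (ℓ′ x) (u x) r (dot xs ℓ u) (dot xs ℓ′ u))

  dot-cong : ∀ xs ℓ {u u′ : X → ℚ} → All (λ x → u x ≡ u′ x) xs → dot xs ℓ u ≡ dot xs ℓ u′
  dot-cong [] ℓ [] = refl
  dot-cong (x ∷ xs) ℓ (e ∷ es) = cong₂ _+_ (cong (ℓ x *_) e) (dot-cong xs ℓ es)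

  dot-0 : ∀ xs ℓ → dot xs ℓ (λ _ → 0ℚ) ≡ 0ℚ
  dot-0 [] ℓ = refl
  dot-0 (x ∷ xs) ℓ = trans (cong₂ _+_ (*-zeroʳ (ℓ x)) (dot-0 xs ℓ)) (+-identityʳ 0ℚ)

  update : X → ℚ → (X → ℚ) → X → ℚ
  update x₀ a u x with x ≟ₓ x₀
  ... | yes _ = a
  ... | no _ = u x

  update-≡ : ∀ x₀ a u → update x₀ a u x₀ ≡ a
  update-≡ x₀ a u with x₀ ≟ₓ x₀
  ... | yes _ = refl
  ... | no x₀≢x₀ = contradiction refl x₀≢x₀

  update-≢ : ∀ x₀ a u {x} → x₀ ≢ x → update x₀ a u x ≡ u x
  update-≢ x₀ a u {x} x₀≢x with x ≟ₓ x₀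
  ... | yes x≡x₀ = contradiction (sym x≡x₀) x₀≢x
  ... | no _ = refl

  record Pivot (x₀ : X) (L : List (X → ℚ)) : Set₁ where
    field
      ℓ* : X → ℚ
      ℓ*x₀≢0 : ℓ* x₀ ≢ 0ℚ
      rest : List (X → ℚ)
      length-rest : length L ≡ suc (length rest)
      -- L is ℓ* ∷ rest up to order.
      all⁺ : ∀ (P : (X → ℚ) → Set) → P ℓ* → All P rest → All P L

    instance
      ℓ*x₀-nonZero : NonZero (ℓ* x₀)
      ℓ*x₀-nonZero = ≢-nonZero ℓ*x₀≢0

    ratio : (X → ℚ) → ℚ
    ratio ℓ = ℓ x₀ * 1/ ℓ* x₀

    eliminated : List (X → ℚ)
    eliminated = map (λ ℓ x → ℓ x - ratio ℓ * ℓ* x) rest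

  pivot : ∀ x₀ (L : List (X → ℚ)) → All (λ ℓ → ℓ x₀ ≡ 0ℚ) L ⊎ Pivot x₀ L
  pivot x₀ [] = inj₁ []
  pivot x₀ (ℓ ∷ L) with ℓ x₀ ≟ 0ℚ
  ... | no ℓx₀≢0 = inj₂ record { ℓ*x₀≢0 = ℓx₀≢0 ; length-rest = refl ; all⁺ = λ P → _∷_ }
  ... | yes ℓx₀≡0 with pivot x₀ L
  ...   | inj₁ zeros = inj₁ (ℓx₀≡0 ∷ zeros)
  ...   | inj₂ p = inj₂ record
    { ℓ*x₀≢0 = ℓ*x₀≢0
    ; rest = ℓ ∷ rest
    ; length-rest = cong suc length-rest
    ; all⁺ = λ { P Pℓ* (Pℓ ∷ Prest) → Pℓ ∷ all⁺ P Pℓ* Prest }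
    }
    where open Pivot p

  NonzeroSolution : List X → List (X → ℚ) → Set
  NonzeroSolution xs L = ∃[ u ] (∃[ x ] x ∈ xs × u x ≢ 0ℚ) × All (λ ℓ → dot xs ℓ u ≡ 0ℚ) L

  dot-update : ∀ {x₀ xs} → All (x₀ ≢_) xs → ∀ ℓ a u →
               dot (x₀ ∷ xs) ℓ (update x₀ a u) ≡ ℓ x₀ * a + dot xs ℓ u
  dot-update {x₀} {xs} x₀∉xs ℓ a u =
    cong₂ _+_ (cong (ℓ x₀ *_) (update-≡ x₀ a u)) (dot-cong xs ℓ (All.map (update-≢ x₀ a u) x₀∉xs))

  unit-solution : ∀ {x₀ xs L} → All (x₀ ≢_) xs → All (λ ℓ → ℓ x₀ ≡ 0ℚ) L → NonzeroSolution (x₀ ∷ xs) L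
  unit-solution {x₀} {xs} x₀∉xs zeros = u , (x₀ , here refl , ux₀≢0) , All.map (λ {ℓ} → solves {ℓ}) zeros
    where
      u = update x₀ 1ℚ (λ _ → 0ℚ)
      ux₀≢0 : u x₀ ≢ 0ℚ
      ux₀≢0 ux₀≡0 = 1≢0 (trans (sym (update-≡ x₀ 1ℚ (λ _ → 0ℚ))) ux₀≡0)
      solves : ∀ {ℓ} → ℓ x₀ ≡ 0ℚ → dot (x₀ ∷ xs) ℓ u ≡ 0ℚ
      solves {ℓ} ℓx₀≡0 = begin
        dot (x₀ ∷ xs) ℓ u                 ≡⟨ dot-update x₀∉xs ℓ 1ℚ (λ _ → 0ℚ) ⟩
        ℓ x₀ * 1ℚ + dot xs ℓ (λ _ → 0ℚ)   ≡⟨ cong₂ _+_ (trans (*-identityʳ (ℓ x₀)) ℓx₀≡0) (dot-0 xs ℓ) ⟩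
        0ℚ + 0ℚ                           ≡⟨ +-identityʳ 0ℚ ⟩
        0ℚ                                ∎
        where open ≡-Reasoning

  back-substitution : ∀ {x₀ xs L} → All (x₀ ≢_) xs → (p : Pivot x₀ L) →
                      NonzeroSolution xs (Pivot.eliminated p) → NonzeroSolution (x₀ ∷ xs) L
  back-substitution {x₀} {xs} x₀∉xs p (u′ , (x₁ , x₁∈xs , u′x₁≢0) , solves′) =
    u , (x₁ , there x₁∈xs , ux₁≢0) , all⁺ (λ ℓ → dot (x₀ ∷ xs) ℓ u ≡ 0ℚ) solves-ℓ* (All.tabulate solves-rest)
    where
      open Pivot p
      D = dot xs ℓ* u′
      a = - D * 1/ ℓ* x₀
      u = update x₀ a u′
      ux₁≢0 : u x₁ ≢ 0ℚ
      ux₁≢0 ux₁≡0 = u′x₁≢0 (trans (sym (update-≢ x₀ a u′ (All.lookup x₀∉xs x₁∈xs))) ux₁≡0)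
      solves-ℓ* : dot (x₀ ∷ xs) ℓ* u ≡ 0ℚ
      solves-ℓ* = begin
        dot (x₀ ∷ xs) ℓ* u                ≡⟨ dot-update x₀∉xs ℓ* a u′ ⟩
        ℓ* x₀ * (- D * 1/ ℓ* x₀) + D
          ≡⟨ solve 3 (λ w i D → w :* (:- D :* i) :+ D := D :* (con 1ℚ :- w :* i)) refl (ℓ* x₀) (1/ ℓ* x₀) D ⟩
        D * (1ℚ - ℓ* x₀ * 1/ ℓ* x₀)       ≡⟨ cong (λ z → D * (1ℚ - z)) (*-inverseʳ (ℓ* x₀)) ⟩
        D * (1ℚ - 1ℚ)                     ≡⟨ trans (cong (D *_) (+-inverseʳ 1ℚ)) (*-zeroʳ D) ⟩
        0ℚ                                ∎
        where open ≡-Reasoning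
      solves-rest : ∀ {ℓ} → ℓ ∈ rest → dot (x₀ ∷ xs) ℓ u ≡ 0ℚ
      solves-rest {ℓ} ℓ∈rest = begin
        dot (x₀ ∷ xs) ℓ u                  ≡⟨ dot-update x₀∉xs ℓ a u′ ⟩
        ℓ x₀ * (- D * 1/ ℓ* x₀) + dot xs ℓ u′
          ≡⟨ solve 4 (λ l i D E → l :* (:- D :* i) :+ E := E :- l :* i :* D) refl (ℓ x₀) (1/ ℓ* x₀) D (dot xs ℓ u′) ⟩
        dot xs ℓ u′ - ratio ℓ * D          ≡⟨ sym (dot-minus-* xs ℓ ℓ* u′ (ratio ℓ)) ⟩
        dot xs (λ x → ℓ x - ratio ℓ * ℓ* x) u′
          ≡⟨ All.lookup (All.map⁻ solves′) ℓ∈rest ⟩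
        0ℚ                                 ∎
        where open ≡-Reasoning

  underdetermined-system : ∀ xs → Unique xs → (L : List (X → ℚ)) → length L < length xs → NonzeroSolution xs L
  underdetermined-system (x₀ ∷ xs) (x₀∉xs ∷ uniq) L len< with pivot x₀ L
  ... | inj₁ zeros = unit-solution x₀∉xs zeros
  ... | inj₂ p = back-substitution x₀∉xs p (underdetermined-system xs uniq eliminated len′<)
    where
      open Pivot p
      len′< : length eliminated < length xs
      len′< = subst (_< length xs) (sym (List.length-map _ rest))
                    (ℕ.≤-pred (subst (_< suc (length xs)) length-rest len<))

-- Subsets containing more than half of the cube

length-filterᵇ-not : ∀ {X : Set} (S : X → Bool) xs →
  length (filterᵇ S xs) ℕ.+ length (filterᵇ (not ∘ S) xs) ≡ length xs
length-filterᵇ-not S [] = refl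
length-filterᵇ-not S (x ∷ xs) with S x
... | true = cong suc (length-filterᵇ-not S xs)
... | false = trans (ℕ.+-suc _ _) (cong suc (length-filterᵇ-not S xs))

sumℚ-pm-filterᵇ : ∀ {X : Set} (S : X → Bool) xs →
  sumℚ (map (pm ∘ S) xs) ≡ toℚ (length (filterᵇ (not ∘ S) xs)) - toℚ (length (filterᵇ S xs))
sumℚ-pm-filterᵇ S [] = refl
sumℚ-pm-filterᵇ S (x ∷ xs) with S x
... | true = trans (cong (- 1ℚ +_) (sumℚ-pm-filterᵇ S xs))
                   (solve 2 (λ a b → :- con 1ℚ :+ (a :- b) := a :- (con 1ℚ :+ b)) refl
                     (toℚ (length (filterᵇ (not ∘ S) xs))) (toℚ (length (filterᵇ S xs))))
... | false = trans (cong (1ℚ +_) (sumℚ-pm-filterᵇ S xs))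
                    (solve 2 (λ a b → con 1ℚ :+ (a :- b) := (con 1ℚ :+ a) :- b) refl
                      (toℚ (length (filterᵇ (not ∘ S) xs))) (toℚ (length (filterᵇ S xs))))

count : ∀ {m} → (Vec Bool m → Bool) → ℕ
count {m} S = length (filterᵇ S (allInputs m))

count-not∘not : ∀ {m} (S : Vec Bool m → Bool) → count (not ∘ not ∘ S) ≡ count S
count-not∘not {m} S = cong length (List.filter-≐ (T? ∘ not ∘ not ∘ S) (T? ∘ S)
  ((λ {x} → subst T (Bool.not-involutive (S x))) , (λ {x} → subst T (sym (Bool.not-involutive (S x)))))
  (allInputs m))

∑-pm≡count-count : ∀ {m} (S : Vec Bool m → Bool) → ∑ (pm ∘ S) ≡ toℚ (count (not ∘ S)) - toℚ (count S)
∑-pm≡count-count {m} S = trans (sym (sumℚ-allInputs (pm ∘ S))) (sumℚ-pm-filterᵇ S (allInputs m))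

dot-allInputs-δ : ∀ {m} x (u : Fun m) → LinearAlgebra.dot (Vec.≡-dec Bool._≟_) (allInputs m) (δ x) u ≡ u x
dot-allInputs-δ x u = trans (sumℚ-allInputs (λ y → δ x y * u y)) (∑-δ x u)

-- If S contains more than half of the cube, the 2 |∁S| linear conditions v x = 0 and A v x = 0 for x
-- outside S leave a nonzero solution.
A-supported-vector : ∀ {m} (S : Vec Bool m → Bool) → count (not ∘ S) < count S →
  ∃[ v ] (∃[ x₀ ] v x₀ ≢ 0ℚ) × SupportedOn S v × SupportedOn S (A v)
A-supported-vector {m} S small = extract (underdetermined-system (allInputs m) (allInputs-unique m) L length-L<)
  where
    open LinearAlgebra (Vec.≡-dec Bool._≟_)
    F = filterᵇ (not ∘ S) (allInputs m)
    L = map δ F ++ map (A ∘ δ) F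
    length-L< : length L < length (allInputs m)
    length-L< = begin-strict
      length L                                   ≡⟨ List.length-++ (map δ F) ⟩
      length (map δ F) ℕ.+ length (map (A ∘ δ) F) ≡⟨ cong₂ ℕ._+_ (List.length-map δ F) (List.length-map (A ∘ δ) F) ⟩
      length F ℕ.+ length F                      <⟨ ℕ.+-monoʳ-< (length F) small ⟩
      length F ℕ.+ count S                       ≡⟨ ℕ.+-comm (length F) (count S) ⟩
      count S ℕ.+ length F                       ≡⟨ length-filterᵇ-not S (allInputs m) ⟩
      length (allInputs m)                       ∎
      where open ℕ.≤-Reasoning
    ∉S⇒∈F : ∀ x → S x ≡ false → x ∈ F
    ∉S⇒∈F x Sx≡false = ∈-filter⁺ (T? ∘ not ∘ S) (allInputs-complete x) (subst (T ∘ not) (sym Sx≡false) _)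
    extract : NonzeroSolution (allInputs m) L → ∃[ v ] (∃[ x₀ ] v x₀ ≢ 0ℚ) × SupportedOn S v × SupportedOn S (A v)
    extract (v , (x₀ , _ , vx₀≢0) , solves) = v , (x₀ , vx₀≢0) , supp , suppA
      where
        supp : SupportedOn S v
        supp x Sx≡false = trans (sym (dot-allInputs-δ x v))
                                (All.lookup (All.map⁻ (All.++⁻ˡ (map δ F) solves)) (∉S⇒∈F x Sx≡false))
        suppA : SupportedOn S (A v)
        suppA x Sx≡false = begin
          A v x                                  ≡⟨ sym (∑-δ x (A v)) ⟩
          ⟨ δ x , A v ⟩                           ≡⟨ sym (A-selfAdjoint (δ x) v) ⟩
          ⟨ A (δ x) , v ⟩                         ≡⟨ sym (sumℚ-allInputs {m} (λ y → A (δ x) y * v y)) ⟩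
          dot (allInputs m) (A (δ x)) v
            ≡⟨ All.lookup (All.map⁻ (All.++⁻ʳ (map δ F) solves)) (∉S⇒∈F x Sx≡false) ⟩
          0ℚ                                     ∎
          where open ≡-Reasoning

large-subset⇒m≤d*d : ∀ {m} d (S : Vec Bool m → Bool) → count (not ∘ S) < count S →
  (∀ x → S x ≡ true → degreeIn S x ≤ d) → m ≤ d ℕ.* d
large-subset⇒m≤d*d d S small deg≤d with A-supported-vector S small
... | v , (x₀ , vx₀≢0) , supp , suppA = A-supported⇒m≤d*d d S v supp suppA deg≤d x₀ vx₀≢0

-- Sensitivity of a point

parity : ∀ {m} → Vec Bool m → Bool
parity [] = false
parity (b ∷ x) = b xor parity x

parity-flipBit : ∀ {m} (x : Vec Bool m) j → parity (flipBit x j) ≡ not (parity x)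
parity-flipBit (b ∷ x) zero = sym (Bool.not-distribˡ-xor b (parity x))
parity-flipBit (b ∷ x) (suc j) = trans (cong (b xor_) (parity-flipBit x j)) (sym (Bool.not-distribʳ-xor b (parity x)))

parityLevel : ∀ {m} → Bool → (Vec Bool m → Bool) → Vec Bool m → Bool
parityLevel c h x = c xor (h x xor parity x)

parityLevel-flipBit : ∀ {m} c (h : Vec Bool m → Bool) x j →
  parityLevel c h (flipBit x j) ≡ not (parityLevel c h x) xor (h x xor h (flipBit x j))
parityLevel-flipBit c h x j = trans (cong (λ p → c xor (h (flipBit x j) xor p)) (parity-flipBit x j))
  (Bool-solve 4 (λ c a b p → c ⊕ (b ⊕ (Bool-con true ⊕ p)) ⊜ (Bool-con true ⊕ (c ⊕ (a ⊕ p))) ⊕ (a ⊕ b)) refl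
               c (h x) (h (flipBit x j)) (parity x))
  where open xor-∧-Solver using () renaming (solve to Bool-solve; con to Bool-con; _:+_ to _⊕_; _:=_ to _⊜_)

degreeIn-cong : ∀ {m} {S S′ : Vec Bool m → Bool} x → (∀ j → S (flipBit x j) ≡ S′ (flipBit x j)) →
                degreeIn S x ≡ degreeIn S′ x
degreeIn-cong [] _ = refl
degreeIn-cong (b ∷ x) S≗S′ = cong₂ ℕ._+_ (cong b2n (S≗S′ zero)) (degreeIn-cong x (λ j → S≗S′ (suc j)))

sum-allFin-suc : ∀ {n} (g : Fin (suc n) → ℕ) → sum (map g (allFin (suc n))) ≡ g zero ℕ.+ sum (map (g ∘ suc) (allFin n))
sum-allFin-suc g = cong (λ gs → g zero ℕ.+ sum gs) (trans (List.map-tabulate suc g) (sym (List.map-tabulate (λ j → j) (g ∘ suc))))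

sensAt-∷ : ∀ {m} (f : Vec Bool (suc m) → Bool) b x →
  sensAt f (b ∷ x) ≡ b2n (f (b ∷ x) xor f (not b ∷ x)) ℕ.+ sensAt (λ y → f (b ∷ y)) x
sensAt-∷ f b x = sum-allFin-suc (λ j → b2n (f (b ∷ x) xor f (flipBit (b ∷ x) j)))

sensAt≡degreeIn : ∀ {m} (f : Vec Bool m → Bool) x → sensAt f x ≡ degreeIn (λ y → f x xor f y) x
sensAt≡degreeIn f [] = refl
sensAt≡degreeIn f (b ∷ x) =
  trans (sensAt-∷ f b x) (cong (b2n (f (b ∷ x) xor f (not b ∷ x)) ℕ.+_) (sensAt≡degreeIn (λ y → f (b ∷ y)) x))

-- Flipping a coordinate flips the parity, so a neighbour of x lies in the level set exactly when h changes value.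
degreeIn-parityLevel : ∀ {m} c (h : Vec Bool m → Bool) x → parityLevel c h x ≡ true →
  degreeIn (parityLevel c h) x ≡ sensAt h x
degreeIn-parityLevel c h x x∈S =
  trans (degreeIn-cong {S = parityLevel c h} {S′ = λ y → h x xor h y} x neighbour) (sym (sensAt≡degreeIn h x))
  where
    neighbour : ∀ j → parityLevel c h (flipBit x j) ≡ h x xor h (flipBit x j)
    neighbour j = trans (parityLevel-flipBit c h x j) (cong (λ b → not b xor (h x xor h (flipBit x j))) x∈S)

-- The coefficient of x₁⋯xₘ in the multilinear representation of g.
topCoeff : ∀ {m} → Fun m → ℚ
topCoeff {zero} g = g []
topCoeff {suc m} g = topCoeff (λ x → g (true ∷ x)) - topCoeff (λ x → g (false ∷ x))

alternating : ℕ → ℚ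
alternating zero = 1ℚ
alternating (suc m) = - alternating m

alternating≢0 : ∀ m → alternating m ≢ 0ℚ
alternating≢0 zero = 1≢0
alternating≢0 (suc m) -s≡0 = alternating≢0 m (neg-injective -s≡0)

pm-xor : ∀ a b → pm (a xor b) ≡ pm a * pm b
pm-xor false b = sym (*-identityˡ (pm b))
pm-xor true false = refl
pm-xor true true = refl

pm≡1-2bit : ∀ b → pm b ≡ 1ℚ - (1ℚ + 1ℚ) * bit b
pm≡1-2bit true = refl
pm≡1-2bit false = refl

∑-parity : ∀ {m} (g : Fun m) → ∑ (λ x → pm (parity x) * g x) ≡ alternating m * topCoeff g
∑-parity {zero} g = refl
∑-parity {suc m} g = begin
  ∑ (λ x → pm (parity x) * g₀ x) + ∑ (λ x → pm (true xor parity x) * g₁ x)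
    ≡⟨ cong (∑ (λ x → pm (parity x) * g₀ x) +_)
            (trans (∑-cong (λ x → trans (cong (_* g₁ x) (pm-xor true (parity x))) (*-assoc (- 1ℚ) (pm (parity x)) (g₁ x))))
                   (∑-* {m} (- 1ℚ) (λ x → pm (parity x) * g₁ x))) ⟩
  ∑ (λ x → pm (parity x) * g₀ x) + - 1ℚ * ∑ (λ x → pm (parity x) * g₁ x)
    ≡⟨ cong₂ (λ p q → p + - 1ℚ * q) (∑-parity g₀) (∑-parity g₁) ⟩
  s * topCoeff g₀ + - 1ℚ * (s * topCoeff g₁)
    ≡⟨ solve 3 (λ s a b → s :* a :+ :- con 1ℚ :* (s :* b) := :- s :* (b :- a)) refl s (topCoeff g₀) (topCoeff g₁) ⟩
  - s * (topCoeff g₁ - topCoeff g₀) ∎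
  where open ≡-Reasoning
        s = alternating m
        g₀ = λ x → g (false ∷ x)
        g₁ = λ x → g (true ∷ x)

∑-pm-parityLevel : ∀ {m} (h : Vec Bool (suc m) → Bool) →
  ∑ (λ x → pm (parityLevel false h x)) ≡ - ((1ℚ + 1ℚ) * (alternating (suc m) * topCoeff (bit ∘ h)))
∑-pm-parityLevel {m} h = begin
  ∑ (λ x → pm (h x xor parity x))
    ≡⟨ ∑-cong (λ x → trans (pm-xor (h x) (parity x)) (trans (*-comm (pm (h x)) _) (cong (pm (parity x) *_) (pm≡1-2bit (h x))))) ⟩
  ∑ (λ x → pm (parity x) * (1ℚ - 2ℚ * bit (h x)))
    ≡⟨ ∑-cong (λ x → *-distribˡ-minus (pm (parity x)) 1ℚ (2ℚ * bit (h x))) ⟩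
  ∑ (λ x → pm (parity x) * 1ℚ - pm (parity x) * (2ℚ * bit (h x)))
    ≡⟨ ∑-minus {suc m} (λ x → pm (parity x) * 1ℚ) (λ x → pm (parity x) * (2ℚ * bit (h x))) ⟩
  ∑ {suc m} (λ x → pm (parity x) * 1ℚ) - ∑ (λ x → pm (parity x) * (2ℚ * bit (h x)))
    ≡⟨ cong₂ _-_ (∑-parity {suc m} (λ _ → 1ℚ))
                 (trans (∑-cong (λ x → *-swapˡ (pm (parity x)) 2ℚ (bit (h x))))
                        (trans (∑-* {suc m} 2ℚ (λ x → pm (parity x) * bit (h x))) (cong (2ℚ *_) (∑-parity (bit ∘ h))))) ⟩
  s * (t - t) - 2ℚ * (s * topCoeff (bit ∘ h))
    ≡⟨ cong (λ z → s * z - 2ℚ * (s * topCoeff (bit ∘ h))) (+-inverseʳ t) ⟩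
  s * 0ℚ - 2ℚ * (s * topCoeff (bit ∘ h))
    ≡⟨ solve 3 (λ s T two → s :* con 0ℚ :- two :* (s :* T) := :- (two :* (s :* T))) refl s (topCoeff (bit ∘ h)) 2ℚ ⟩
  - (2ℚ * (s * topCoeff (bit ∘ h))) ∎
  where open ≡-Reasoning
        s = alternating (suc m)
        t = topCoeff {m} (λ _ → 1ℚ)
        2ℚ = 1ℚ + 1ℚ

∑-pm-parityLevel≢0 : ∀ {m} (h : Vec Bool (suc m) → Bool) → topCoeff (bit ∘ h) ≢ 0ℚ →
  ∑ (λ x → pm (parityLevel false h x)) ≢ 0ℚ
∑-pm-parityLevel≢0 {m} h top≢0 ∑≡0 =
  top≢0 (p*q≡0⇒q≡0 s _ (alternating≢0 (suc m))
    (p*q≡0⇒q≡0 (1ℚ + 1ℚ) _ (λ ()) (neg-injective (trans (sym (∑-pm-parityLevel h)) ∑≡0))))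
  where s = alternating (suc m)

huang-sensitivity : ∀ {m} (h : Vec Bool m → Bool) d → (∀ x → sensAt h x ≤ d) → topCoeff (bit ∘ h) ≢ 0ℚ → m ≤ d ℕ.* d
huang-sensitivity {zero} h d _ _ = z≤n
huang-sensitivity {suc m} h d sens≤d top≢0 = by-cases (ℕ.<-cmp (count S₁) (count S₀))
  where
    S₀ = parityLevel false h
    S₁ = parityLevel true h
    degree≤d : ∀ c x → parityLevel c h x ≡ true → degreeIn (parityLevel c h) x ≤ d
    degree≤d c x x∈S = subst (_≤ d) (sym (degreeIn-parityLevel c h x x∈S)) (sens≤d x)
    by-cases : Tri (count S₁ < count S₀) (count S₁ ≡ count S₀) (count S₀ < count S₁) → suc m ≤ d ℕ.* d
    by-cases (tri< S₁<S₀ _ _) = large-subset⇒m≤d*d d S₀ S₁<S₀ (degree≤d false)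
    by-cases (tri> _ _ S₀<S₁) =
      large-subset⇒m≤d*d d S₁ (subst (_< count S₁) (sym (count-not∘not S₀)) S₀<S₁) (degree≤d true)
    by-cases (tri≈ _ S₁≡S₀ _) = contradiction balanced (∑-pm-parityLevel≢0 h top≢0)
      where
        balanced : ∑ (pm ∘ S₀) ≡ 0ℚ
        balanced = trans (∑-pm≡count-count S₀)
                         (trans (cong (λ n → toℚ n - toℚ (count S₀)) S₁≡S₀) (+-inverseʳ (toℚ (count S₀))))

-- Sensitivity of a coordinate

foldr-⊔-≥ : ∀ {n} ns → n ∈ ns → n ≤ foldr ℕ._⊔_ 0 ns
foldr-⊔-≥ (n ∷ ns) (here refl) = ℕ.m≤m⊔n n _
foldr-⊔-≥ (m ∷ ns) (there n∈ns) = ℕ.≤-trans (foldr-⊔-≥ ns n∈ns) (ℕ.m≤n⊔m m _)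

foldr-⊔-≤ : ∀ {b} ns → (∀ {n} → n ∈ ns → n ≤ b) → foldr ℕ._⊔_ 0 ns ≤ b
foldr-⊔-≤ [] _ = z≤n
foldr-⊔-≤ (n ∷ ns) ns≤b = ℕ.⊔-lub (ns≤b (here refl)) (foldr-⊔-≤ ns (ns≤b ∘ there))

sens-≥ : ∀ {n} (f : Vec Bool n → Bool) i x → f x xor f (flipBit x i) ≡ true →
  sensAt f x ℕ.+ sensAt f (flipBit x i) ≤ sens f i
sens-≥ {n} f i x x∈edge = foldr-⊔-≥ (map edgeSens edges) (∈-map⁺ edgeSens (∈-filter⁺ isEdge? (allInputs-complete x) x∈edge))
  where
    edgeSens = λ x → sensAt f x ℕ.+ sensAt f (flipBit x i)
    isEdge? = λ x → f x xor f (flipBit x i) Bool.≟ true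
    edges = filter isEdge? (allInputs n)

sens-≤ : ∀ {n} (f : Vec Bool n → Bool) i b →
  (∀ x → f x xor f (flipBit x i) ≡ true → sensAt f x ℕ.+ sensAt f (flipBit x i) ≤ b) → sens f i ≤ b
sens-≤ {n} f i b edge≤b = foldr-⊔-≤ (map edgeSens edges) λ n∈ → case ∈-map⁻ edgeSens n∈ of λ
  { (x , x∈ , refl) → edge≤b x (proj₂ (∈-filter⁻ isEdge? {xs = allInputs n} x∈)) }
  where
    edgeSens = λ x → sensAt f x ℕ.+ sensAt f (flipBit x i)
    isEdge? = λ x → f x xor f (flipBit x i) Bool.≟ true
    edges = filter isEdge? (allInputs n)

sum-allFin-≥ : ∀ {n} (g : Fin n → ℕ) j → g j ≤ sum (map g (allFin n))
sum-allFin-≥ {suc n} g zero = subst (g zero ≤_) (sym (sum-allFin-suc g)) (ℕ.m≤m+n _ _)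
sum-allFin-≥ {suc n} g (suc j) =
  subst (g (suc j) ≤_) (sym (sum-allFin-suc g)) (ℕ.≤-trans (sum-allFin-≥ (g ∘ suc) j) (ℕ.m≤n+m _ _))

sum-allFin-b2n-pos : ∀ {n} (p : Fin n → Bool) → 0 < sum (map (b2n ∘ p) (allFin n)) → ∃[ j ] p j ≡ true
sum-allFin-b2n-pos {suc n} p pos rewrite sum-allFin-suc (b2n ∘ p) with p zero in p₀
... | true = zero , p₀
... | false with sum-allFin-b2n-pos (p ∘ suc) pos
...   | j , pj = suc j , pj

flipBit-involutive : ∀ {n} (x : Vec Bool n) j → flipBit (flipBit x j) j ≡ x
flipBit-involutive (b ∷ x) zero = cong (_∷ x) (Bool.not-involutive b)
flipBit-involutive (b ∷ x) (suc j) = cong (b ∷_) (flipBit-involutive x j)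

-- A point of sensitivity ≥ k has a sensitive edge, whose other endpoint has sensitivity ≥ 1.
sensAt≤pred : ∀ {n} (f : Vec Bool n → Bool) k → 1 ≤ k → (∀ i → sens f i ≤ k) → ∀ x → sensAt f x ≤ k ∸ 1
sensAt≤pred {n} f (suc k) _ sens≤k x = ℕ.s≤s⁻¹ (ℕ.≰⇒> k<sx-impossible)
  where
    k<sx-impossible : ¬ (suc k ≤ sensAt f x)
    k<sx-impossible k<sx with sum-allFin-b2n-pos (λ j → f x xor f (flipBit x j)) (ℕ.<-≤-trans (s≤s z≤n) k<sx)
    ... | j , edge = ℕ.<-irrefl refl (ℕ.≤-trans k+1<sx+sx′ (ℕ.≤-trans (sens-≥ f j x edge) (sens≤k j)))
      where
        x′ = flipBit x j
        edge′ : f x′ xor f (flipBit x′ j) ≡ true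
        edge′ = trans (cong (λ y → f x′ xor f y) (flipBit-involutive x j)) (trans (Bool.xor-comm (f x′) (f x)) edge)
        1≤sx′ : 1 ≤ sensAt f x′
        1≤sx′ = subst (_≤ sensAt f x′) (cong b2n edge′) (sum-allFin-≥ (λ i → b2n (f x′ xor f (flipBit x′ i))) j)
        k+1<sx+sx′ : suc (suc k) ≤ sensAt f x ℕ.+ sensAt f x′
        k+1<sx+sx′ = subst (_≤ sensAt f x ℕ.+ sensAt f x′) (ℕ.+-comm (suc k) 1) (ℕ.+-mono-≤ k<sx 1≤sx′)

-- Restrictions to subcubes

merge : ∀ {n} (T : Vec Bool n) → Vec Bool ∣ T ∣ → Vec Bool n → Vec Bool n
merge [] [] [] = []
merge (true ∷ T) (y ∷ ys) (_ ∷ z) = y ∷ merge T ys z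
merge (false ∷ T) ys (b ∷ z) = b ∷ merge T ys z

index : ∀ {n} (T : Vec Bool n) → Fin ∣ T ∣ → Fin n
index (true ∷ T) zero = zero
index (true ∷ T) (suc j) = suc (index T j)
index (false ∷ T) j = suc (index T j)

lookup-index : ∀ {n} (T : Vec Bool n) j → lookup T (index T j) ≡ true
lookup-index (true ∷ T) zero = refl
lookup-index (true ∷ T) (suc j) = lookup-index T j
lookup-index (false ∷ T) j = lookup-index T j

merge-flipBit : ∀ {n} (T : Vec Bool n) y z j → merge T (flipBit y j) z ≡ flipBit (merge T y z) (index T j)
merge-flipBit (true ∷ T) (y ∷ ys) (_ ∷ z) zero = refl
merge-flipBit (true ∷ T) (y ∷ ys) (_ ∷ z) (suc j) = cong (y ∷_) (merge-flipBit T ys z j)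
merge-flipBit (false ∷ T) ys (b ∷ z) j = cong (b ∷_) (merge-flipBit T ys z j)

sensAt-merge : ∀ {n} (T : Vec Bool n) z (f : Vec Bool n → Bool) y →
  sensAt (λ w → f (merge T w z)) y ≤ sensAt f (merge T y z)
sensAt-merge [] [] f [] = z≤n
sensAt-merge (true ∷ T) (c ∷ z) f (a ∷ ys) =
  subst₂ _≤_ (sym (sensAt-∷ (λ w → f (merge (true ∷ T) w (c ∷ z))) a ys)) (sym (sensAt-∷ f a (merge T ys z)))
    (ℕ.+-monoʳ-≤ (b2n (f (a ∷ merge T ys z) xor f (not a ∷ merge T ys z))) (sensAt-merge T z (λ w → f (a ∷ w)) ys))
sensAt-merge (false ∷ T) (c ∷ z) f ys =
  subst (sensAt (λ w → f (c ∷ merge T w z)) ys ≤_) (sym (sensAt-∷ f c (merge T ys z)))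
    (ℕ.≤-trans (sensAt-merge T z (λ w → f (c ∷ w)) ys) (ℕ.m≤n+m _ _))

sens-merge : ∀ {n} (T : Vec Bool n) z (f : Vec Bool n → Bool) j → sens (λ w → f (merge T w z)) j ≤ sens f (index T j)
sens-merge T z f j = sens-≤ (λ w → f (merge T w z)) j (sens f (index T j)) λ y edge →
  let x = merge T y z
      merge-flip = merge-flipBit T y z j
  in ℕ.≤-trans (ℕ.+-mono-≤ (sensAt-merge T z f y)
                           (subst (λ x′ → sensAt (λ w → f (merge T w z)) (flipBit y j) ≤ sensAt f x′) merge-flip
                                  (sensAt-merge T z f (flipBit y j))))
               (sens-≥ f (index T j) x (subst (λ x′ → f x xor f x′ ≡ true) merge-flip edge))

-- Δ T z g is the coefficient of ∏_{i ∈ T} xᵢ in the multilinear representation of the restriction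
-- of g to the subcube on which the coordinates outside T agree with z.
Δ : ∀ {n} (T : Vec Bool n) → Vec Bool n → Fun n → ℚ
Δ [] [] g = g []
Δ (true ∷ T) (_ ∷ z) g = Δ T z (λ y → g (true ∷ y)) - Δ T z (λ y → g (false ∷ y))
Δ (false ∷ T) (b ∷ z) g = Δ T z (λ y → g (b ∷ y))

Δ-cong : ∀ {n} (T z : Vec Bool n) {g h} → (∀ x → g x ≡ h x) → Δ T z g ≡ Δ T z h
Δ-cong [] [] g≗h = g≗h []
Δ-cong (true ∷ T) (_ ∷ z) g≗h = cong₂ _-_ (Δ-cong T z (g≗h ∘ (true ∷_))) (Δ-cong T z (g≗h ∘ (false ∷_)))
Δ-cong (false ∷ T) (b ∷ z) g≗h = Δ-cong T z (g≗h ∘ (b ∷_))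

Δ-+ : ∀ {n} (T z : Vec Bool n) g h → Δ T z (λ x → g x + h x) ≡ Δ T z g + Δ T z h
Δ-+ [] [] g h = refl
Δ-+ (true ∷ T) (_ ∷ z) g h = trans (cong₂ _-_ (Δ-+ T z g₁ h₁) (Δ-+ T z g₀ h₀))
  (+-minus-interchange (Δ T z g₁) (Δ T z h₁) (Δ T z g₀) (Δ T z h₀))
  where g₀ = λ y → g (false ∷ y) ; g₁ = λ y → g (true ∷ y)
        h₀ = λ y → h (false ∷ y) ; h₁ = λ y → h (true ∷ y)
Δ-+ (false ∷ T) (b ∷ z) g h = Δ-+ T z _ _

Δ-* : ∀ {n} (T z : Vec Bool n) c g → Δ T z (λ x → c * g x) ≡ c * Δ T z g
Δ-* [] [] c g = refl
Δ-* (true ∷ T) (_ ∷ z) c g = trans (cong₂ _-_ (Δ-* T z c g₁) (Δ-* T z c g₀)) (sym (*-distribˡ-minus c (Δ T z g₁) (Δ T z g₀)))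
  where g₀ = λ y → g (false ∷ y) ; g₁ = λ y → g (true ∷ y)
Δ-* (false ∷ T) (b ∷ z) c g = Δ-* T z c _

Δ-isLinear : ∀ {n} (T z : Vec Bool n) → IsLinear (Δ T z)
Δ-isLinear T z = record { Φ-cong = Δ-cong T z ; Φ-+ = Δ-+ T z ; Φ-* = Δ-* T z }

Δ-merge : ∀ {n} (T z : Vec Bool n) g → Δ T z g ≡ topCoeff (λ y → g (merge T y z))
Δ-merge [] [] g = refl
Δ-merge (true ∷ T) (_ ∷ z) g = cong₂ _-_ (Δ-merge T z _) (Δ-merge T z _)
Δ-merge (false ∷ T) (b ∷ z) g = Δ-merge T z _

Δ-minus : ∀ {n} (T z : Vec Bool n) g h → Δ T z (λ x → g x - h x) ≡ Δ T z g - Δ T z h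
Δ-minus T z = IsLinear.Φ-minus (Δ-isLinear T z)

-- Coordinates of M outside W are frozen at a value for which the difference does not vanish.
Δ-∩ : ∀ {n} (M W z : Vec Bool n) g → Δ M z g ≢ 0ℚ → ∃[ z′ ] Δ (M ∩ W) z′ g ≢ 0ℚ
Δ-∩ [] [] [] g Δ≢0 = [] , Δ≢0
Δ-∩ (false ∷ M) (_ ∷ W) (b ∷ z) g Δ≢0 = Product.map (b ∷_) id (Δ-∩ M W z _ Δ≢0)
Δ-∩ (true ∷ M) (true ∷ W) (c ∷ z) g Δ≢0 =
  Product.map (c ∷_) (λ {z′} Δ′≢0 → Δ′≢0 ∘ trans (Δ-minus (M ∩ W) z′ _ _))
    (Δ-∩ M W z (λ y → g (true ∷ y) - g (false ∷ y)) (Δ≢0 ∘ trans (sym (Δ-minus M z _ _))))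
Δ-∩ (true ∷ M) (false ∷ W) (c ∷ z) g Δ≢0
  with p-q≢0⇒p≢0⊎q≢0 (Δ M z (λ y → g (true ∷ y))) (Δ M z (λ y → g (false ∷ y))) Δ≢0
... | inj₁ Δ₁≢0 = Product.map (true ∷_) id (Δ-∩ M W z _ Δ₁≢0)
... | inj₂ Δ₀≢0 = Product.map (false ∷_) id (Δ-∩ M W z _ Δ₀≢0)

-- Multilinear and Fourier coefficients

sumℚ-δ : ∀ {n} (c : Fun n) M → sumℚ (map (λ S → c S * δ M S) (allInputs n)) ≡ c M
sumℚ-δ {n} c M = trans (sumℚ-allInputs {n} (λ S → c S * δ M S)) (trans (∑-cong (λ S → *-comm (c S) (δ M S))) (∑-δ M c))

Δ-monomial : ∀ {n} (M S : Vec Bool n) → Δ M (replicate n false) (monomial bit S) ≡ δ M S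
Δ-monomial [] [] = refl
Δ-monomial {suc n} (true ∷ M) (true ∷ S) = begin
  Δ M z (λ y → 1ℚ * monomial bit S y) - Δ M z (λ y → 0ℚ * monomial bit S y)
    ≡⟨ cong₂ _-_ (Δ-* M z 1ℚ (monomial bit S)) (Δ-* M z 0ℚ (monomial bit S)) ⟩
  1ℚ * Δ M z (monomial bit S) - 0ℚ * Δ M z (monomial bit S)
    ≡⟨ solve 1 (λ q → con 1ℚ :* q :- con 0ℚ :* q := q) refl (Δ M z (monomial bit S)) ⟩
  Δ M z (monomial bit S)
    ≡⟨ Δ-monomial M S ⟩
  δ M S ∎
  where open ≡-Reasoning
        z = replicate n false
Δ-monomial {suc n} (true ∷ M) (false ∷ S) = +-inverseʳ (Δ M (replicate n false) (λ y → 1ℚ * monomial bit S y))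
Δ-monomial {suc n} (false ∷ M) (true ∷ S) = trans (Δ-* M _ 0ℚ (monomial bit S)) (*-zeroˡ (Δ M (replicate n false) (monomial bit S)))
Δ-monomial {suc n} (false ∷ M) (false ∷ S) = trans (Δ-* M _ 1ℚ (monomial bit S)) (trans (*-identityˡ _) (Δ-monomial M S))

Δ-representation : ∀ {n} (f : Vec Bool n → Bool) c M → RepresentsML f c → Δ M (replicate n false) (bit ∘ f) ≡ c M
Δ-representation {n} f c M rep = begin
  Δ M z (bit ∘ f)                                                ≡⟨ Δ-cong M z rep ⟩
  Δ M z (λ x → sumℚ (map (λ S → c S * monomial bit S x) I))     ≡⟨ IsLinear.Φ-sumℚ (Δ-isLinear M z) c (monomial bit) I ⟩
  sumℚ (map (λ S → c S * Δ M z (monomial bit S)) I)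
    ≡⟨ cong sumℚ (List.map-cong (λ S → cong (c S *_) (Δ-monomial M S)) I) ⟩
  sumℚ (map (λ S → c S * δ M S) I)                              ≡⟨ sumℚ-δ c M ⟩
  c M                                                            ∎
  where open ≡-Reasoning
        z = replicate n false
        I = allInputs n

-- 2ⁿ times the Fourier coefficient of g at T.
correlation : ∀ {n} → Vec Bool n → Fun n → ℚ
correlation T g = ∑ (λ x → monomial pm T x * g x)

correlation-isLinear : ∀ {n} (T : Vec Bool n) → IsLinear (correlation T)
correlation-isLinear {n} T = record
  { Φ-cong = λ g≗h → ∑-cong (λ x → cong (monomial pm T x *_) (g≗h x))
  ; Φ-+ = λ g h → trans (∑-cong (λ x → *-distribˡ-+ (monomial pm T x) (g x) (h x))) (∑-+ {n} _ _)
  ; Φ-* = λ c g → trans (∑-cong (λ x → solve 3 (λ m c a → m :* (c :* a) := c :* (m :* a)) refl (monomial pm T x) c (g x)))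
                        (∑-* {n} c _)
  }

if-pm-1 : ∀ t → (if t then pm false else 1ℚ) ≡ 1ℚ
if-pm-1 true = refl
if-pm-1 false = refl

if-pm-pm : ∀ t → (if t then pm true else 1ℚ) ≡ pm t
if-pm-pm true = refl
if-pm-pm false = refl

correlation-∷ : ∀ {n} t (T : Vec Bool n) g →
  correlation (t ∷ T) g ≡ correlation T (λ y → g (false ∷ y)) + pm t * correlation T (λ y → g (true ∷ y))
correlation-∷ {n} t T g = cong₂ _+_
  (∑-cong (λ y → cong (_* g (false ∷ y)) (trans (cong (_* monomial pm T y) (if-pm-1 t)) (*-identityˡ (monomial pm T y)))))
  (trans (∑-cong (λ y → trans (cong (λ a → a * monomial pm T y * g (true ∷ y)) (if-pm-pm t)) (*-assoc (pm t) _ _)))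
         (∑-* {n} (pm t) _))

correlation-monomial : ∀ {n} (T S : Vec Bool n) → correlation T (monomial pm S) ≡ ∑ {n} (λ _ → 1ℚ) * δ T S
correlation-monomial [] [] = refl
correlation-monomial {suc n} (t ∷ T) (s ∷ S) = begin
  correlation (t ∷ T) (monomial pm (s ∷ S))
    ≡⟨ correlation-∷ t T (monomial pm (s ∷ S)) ⟩
  correlation T (λ y → a * monomial pm S y) + pm t * correlation T (λ y → b * monomial pm S y)
    ≡⟨ cong₂ (λ p q → p + pm t * q) (Φ-* a (monomial pm S)) (Φ-* b (monomial pm S)) ⟩
  a * correlation T (monomial pm S) + pm t * (b * correlation T (monomial pm S))
    ≡⟨ cong₂ (λ a′ b′ → a′ * C + pm t * (b′ * C)) (if-pm-1 s) (if-pm-pm s) ⟩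
  1ℚ * C + pm t * (pm s * C)
    ≡⟨ cong (λ C → 1ℚ * C + pm t * (pm s * C)) (correlation-monomial T S) ⟩
  1ℚ * (N * δ T S) + pm t * (pm s * (N * δ T S))
    ≡⟨ characters t s ⟩
  (N + N) * δ (t ∷ T) (s ∷ S) ∎
  where
    open ≡-Reasoning
    open IsLinear (correlation-isLinear T)
    a = if s then pm false else 1ℚ
    b = if s then pm true else 1ℚ
    C = correlation T (monomial pm S)
    N = ∑ {n} (λ _ → 1ℚ)
    characters : ∀ t s → 1ℚ * (N * δ T S) + pm t * (pm s * (N * δ T S)) ≡ (N + N) * δ (t ∷ T) (s ∷ S)
    characters true true =
      solve 2 (λ N d → con 1ℚ :* (N :* d) :+ (:- con 1ℚ) :* ((:- con 1ℚ) :* (N :* d)) := (N :+ N) :* d) refl N (δ T S)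
    characters false false =
      solve 2 (λ N d → con 1ℚ :* (N :* d) :+ con 1ℚ :* (con 1ℚ :* (N :* d)) := (N :+ N) :* d) refl N (δ T S)
    characters true false =
      solve 2 (λ N d → con 1ℚ :* (N :* d) :+ (:- con 1ℚ) :* (con 1ℚ :* (N :* d)) := (N :+ N) :* con 0ℚ) refl N (δ T S)
    characters false true =
      solve 2 (λ N d → con 1ℚ :* (N :* d) :+ con 1ℚ :* ((:- con 1ℚ) :* (N :* d)) := (N :+ N) :* con 0ℚ) refl N (δ T S)

correlation-representation : ∀ {n} (f : Vec Bool n → Bool) fh M → FourierRep f fh →
  correlation M (pm ∘ f) ≡ ∑ {n} (λ _ → 1ℚ) * fh M
correlation-representation {n} f fh M rep = begin
  correlation M (pm ∘ f)                                           ≡⟨ Φ-cong rep ⟩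
  correlation M (λ x → sumℚ (map (λ S → fh S * monomial pm S x) I)) ≡⟨ Φ-sumℚ fh (monomial pm) I ⟩
  sumℚ (map (λ S → fh S * correlation M (monomial pm S)) I)
    ≡⟨ cong sumℚ (List.map-cong (λ S → trans (cong (fh S *_) (correlation-monomial M S)) (sym (*-assoc (fh S) N (δ M S)))) I) ⟩
  sumℚ (map (λ S → (fh S * N) * δ M S) I)                          ≡⟨ sumℚ-δ (λ S → fh S * N) M ⟩
  fh M * N                                                         ≡⟨ *-comm (fh M) N ⟩
  N * fh M                                                         ∎
  where open ≡-Reasoning
        open IsLinear (correlation-isLinear M)
        I = allInputs n
        N = ∑ {n} (λ _ → 1ℚ)

monomial-replicate-false : ∀ {n} (v : Bool → ℚ) (x : Vec Bool n) → monomial v (replicate n false) x ≡ 1ℚ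
monomial-replicate-false v [] = refl
monomial-replicate-false v (b ∷ x) = trans (*-identityˡ _) (monomial-replicate-false v x)

δ-≢ : ∀ {n} {x y : Vec Bool n} → x ≢ y → δ x y ≡ 0ℚ
δ-≢ {x = []} {[]} x≢y = contradiction refl x≢y
δ-≢ {x = false ∷ x} {false ∷ y} x≢y = δ-≢ (x≢y ∘ cong (false ∷_))
δ-≢ {x = true ∷ x} {true ∷ y} x≢y = δ-≢ (x≢y ∘ cong (true ∷_))
δ-≢ {x = false ∷ x} {true ∷ y} _ = refl
δ-≢ {x = true ∷ x} {false ∷ y} _ = refl

-- A constant is the character of the empty set, so it is orthogonal to every other character.
correlation-bit : ∀ {n} (f : Vec Bool n → Bool) M → M ≢ replicate n false →
  correlation M (pm ∘ f) ≡ - ((1ℚ + 1ℚ) * correlation M (bit ∘ f))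
correlation-bit {n} f M M≢∅ = begin
  correlation M (pm ∘ f)                                       ≡⟨ Φ-cong (pm≡1-2bit ∘ f) ⟩
  correlation M (λ x → 1ℚ - (1ℚ + 1ℚ) * bit (f x))             ≡⟨ Φ-minus (λ _ → 1ℚ) (λ x → (1ℚ + 1ℚ) * bit (f x)) ⟩
  correlation M (λ _ → 1ℚ) - correlation M (λ x → (1ℚ + 1ℚ) * bit (f x))
    ≡⟨ cong₂ _-_ (trans (Φ-cong (λ x → sym (monomial-replicate-false pm x))) (correlation-monomial M (replicate n false)))
                 (Φ-* (1ℚ + 1ℚ) (bit ∘ f)) ⟩
  ∑ {n} (λ _ → 1ℚ) * δ M (replicate n false) - (1ℚ + 1ℚ) * correlation M (bit ∘ f)
    ≡⟨ cong (λ d → ∑ {n} (λ _ → 1ℚ) * d - (1ℚ + 1ℚ) * correlation M (bit ∘ f)) (δ-≢ M≢∅) ⟩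
  ∑ {n} (λ _ → 1ℚ) * 0ℚ - (1ℚ + 1ℚ) * correlation M (bit ∘ f)
    ≡⟨ trans (cong (_- (1ℚ + 1ℚ) * correlation M (bit ∘ f)) (*-zeroʳ (∑ {n} (λ _ → 1ℚ)))) (+-identityˡ _) ⟩
  - ((1ℚ + 1ℚ) * correlation M (bit ∘ f))                      ∎
  where open ≡-Reasoning
        open IsLinear (correlation-isLinear M)

correlation-Δ : ∀ {n} (T : Vec Bool n) g → correlation T g ≢ 0ℚ → ∃[ z ] Δ T z g ≢ 0ℚ
correlation-Δ [] g c≢0 = [] , c≢0 ∘ trans (*-identityˡ (g []))
correlation-Δ (false ∷ T) g c≢0
  with p+q≢0⇒p≢0⊎q≢0 (correlation T (λ y → g (false ∷ y))) (correlation T (λ y → g (true ∷ y)))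
         (c≢0 ∘ trans (correlation-∷ false T g) ∘ trans (cong (correlation T (λ y → g (false ∷ y)) +_) (*-identityˡ _)))
... | inj₁ c₀≢0 = Product.map (false ∷_) id (correlation-Δ T _ c₀≢0)
... | inj₂ c₁≢0 = Product.map (true ∷_) id (correlation-Δ T _ c₁≢0)
correlation-Δ (true ∷ T) g c≢0 =
  Product.map (false ∷_) (λ {z} Δ≢0 → Δ≢0 ∘ trans (Δ-minus T z g₀ g₁) ∘ p-q≡0⇒q-p≡0 {Δ T z g₁} {Δ T z g₀})
    (correlation-Δ T (λ y → g₀ y - g₁ y) (c≢0 ∘ trans correlation-difference))
  where
    g₀ = λ y → g (false ∷ y)
    g₁ = λ y → g (true ∷ y)
    correlation-difference : correlation (true ∷ T) g ≡ correlation T (λ y → g₀ y - g₁ y)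
    correlation-difference = begin
      correlation (true ∷ T) g                         ≡⟨ correlation-∷ true T g ⟩
      correlation T g₀ + - 1ℚ * correlation T g₁
        ≡⟨ solve 2 (λ a b → a :+ (:- con 1ℚ) :* b := a :- b) refl (correlation T g₀) (correlation T g₁) ⟩
      correlation T g₀ - correlation T g₁              ≡⟨ sym (IsLinear.Φ-minus (correlation-isLinear T) g₀ g₁) ⟩
      correlation T (λ y → g₀ y - g₁ y)               ∎
      where open ≡-Reasoning

sum-allFin-∩ : ∀ {n} (M : Vec Bool n) (w : Fin n → Bool) →
  sum (map (λ i → if lookup M i then b2n (w i) else 0) (allFin n)) ≡ ∣ M ∩ tabulate w ∣
sum-allFin-∩ [] w = refl
sum-allFin-∩ (b ∷ M) w = trans (sum-allFin-suc (λ i → if lookup (b ∷ M) i then b2n (w i) else 0)) (head b (w zero))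
  where
    head : ∀ b c → (if b then b2n c else 0) ℕ.+ sum (map (λ i → if lookup M i then b2n (w (suc i)) else 0) (allFin _))
                   ≡ ∣ (b ∧ c) ∷ M ∩ tabulate (w ∘ suc) ∣
    head true true = cong suc (sum-allFin-∩ M (w ∘ suc))
    head true false = sum-allFin-∩ M (w ∘ suc)
    head false c = sum-allFin-∩ M (w ∘ suc)

low-sensitivity-bound : ∀ {n} (f : Vec Bool n → Bool) k → 1 ≤ k → ∀ M z →
  Δ M z (bit ∘ f) ≢ 0ℚ → countLowSens f k M ≤ (k ∸ 1) ^ 2
low-sensitivity-bound {n} f k 1≤k M z Δ≢0 = subst₂ _≤_
  (sym (sum-allFin-∩ M (λ i → sens f i ℕ.≤ᵇ k))) (cong ((k ∸ 1) ℕ.*_) (sym (ℕ.*-identityʳ (k ∸ 1))))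
  (bound (Δ-∩ M W z (bit ∘ f) Δ≢0))
  where
    W = tabulate (λ i → sens f i ℕ.≤ᵇ k)
    low : ∀ {i} → i ∈ᵥ M ∩ W → sens f i ≤ k
    low {i} i∈M∩W = ℕ.≤ᵇ⇒≤ (sens f i) k
      (subst T (sym (trans (sym (Vec.lookup∘tabulate _ i)) (Vec.[]=⇒lookup (p∩q⊆q M W i∈M∩W)))) _)
    bound : ∃[ z′ ] Δ (M ∩ W) z′ (bit ∘ f) ≢ 0ℚ → ∣ M ∩ W ∣ ≤ (k ∸ 1) ℕ.* (k ∸ 1)
    bound (z′ , Δ′≢0) =
      huang-sensitivity h (k ∸ 1) (sensAt≤pred h k 1≤k sens-h≤k) (Δ′≢0 ∘ trans (Δ-merge (M ∩ W) z′ (bit ∘ f)))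
      where
        h = λ y → f (merge (M ∩ W) y z′)
        sens-h≤k : ∀ j → sens h j ≤ k
        sens-h≤k j = ℕ.≤-trans (sens-merge (M ∩ W) z′ f j) (low (Vec.lookup⇒[]= _ _ (lookup-index (M ∩ W) j)))

countLowSens-∅ : ∀ {n} (f : Vec Bool n → Bool) k → countLowSens f k (replicate n false) ≡ 0
countLowSens-∅ {n} f k = begin
  countLowSens f k (replicate n false)                  ≡⟨ sum-allFin-∩ (replicate n false) (λ i → sens f i ℕ.≤ᵇ k) ⟩
  ∣ replicate n false ∩ tabulate (λ i → sens f i ℕ.≤ᵇ k) ∣ ≡⟨ cong ∣_∣ (∩-zeroˡ (tabulate (λ i → sens f i ℕ.≤ᵇ k))) ⟩
  ∣ replicate n false ∣                                  ≡⟨ ∣⊥∣≡0 n ⟩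
  0                                                     ∎
  where open ≡-Reasoning

fourier-correlation≢0 : ∀ {n} (f : Vec Bool n → Bool) fh M → FourierRep f fh → fh M ≢ 0ℚ → M ≢ replicate n false →
  correlation M (bit ∘ f) ≢ 0ℚ
fourier-correlation≢0 {n} f fh M rep fh≢0 M≢∅ c≡0 = fh≢0 (p*q≡0⇒q≡0 N (fh M) N≢0 (begin
  N * fh M                                     ≡⟨ sym (correlation-representation f fh M rep) ⟩
  correlation M (pm ∘ f)                       ≡⟨ correlation-bit f M M≢∅ ⟩
  - ((1ℚ + 1ℚ) * correlation M (bit ∘ f))      ≡⟨ cong (λ c → - ((1ℚ + 1ℚ) * c)) c≡0 ⟩
  0ℚ                                           ∎))
  where
    open ≡-Reasoning
    N = ∑ {n} (λ _ → 1ℚ)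
    N≢0 : N ≢ 0ℚ
    N≢0 N≡0 = <-irrefl (sym N≡0) (<-≤-trans (positive⁻¹ 1ℚ) (∑-nonNeg-≥ (λ _ → 0≤1) (replicate n false)))

fourier-low-sensitivity-bound : ∀ {n} (f : Vec Bool n → Bool) k → 1 ≤ k → ∀ M fh → FourierRep f fh → fh M ≢ 0ℚ →
  countLowSens f k M ≤ (k ∸ 1) ^ 2
fourier-low-sensitivity-bound {n} f k 1≤k M fh rep fhM≢0 = by-cases (Vec.≡-dec Bool._≟_ M (replicate n false))
  where
    by-cases : Dec (M ≡ replicate n false) → countLowSens f k M ≤ (k ∸ 1) ^ 2
    by-cases (yes M≡∅) = ℕ.≤-trans (ℕ.≤-reflexive (trans (cong (countLowSens f k) M≡∅) (countLowSens-∅ f k))) z≤n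
    by-cases (no M≢∅) = uncurry (low-sensitivity-bound f k 1≤k M)
      (correlation-Δ M (bit ∘ f) (fourier-correlation≢0 f fh M rep fhM≢0 M≢∅))

lemma5 : ∀ {n : ℕ} (f : Vec Bool n → Bool) (k : ℕ) → 1 ≤ k → (M : Vec Bool n) →
    ((c : Vec Bool n → ℚ) → RepresentsML f c → c M ≢ 0ℚ →
       countLowSens f k M ≤ (k ∸ 1) ^ 2)
    × ((fh : Vec Bool n → ℚ) → FourierRep f fh → fh M ≢ 0ℚ →
       countLowSens f k M ≤ (k ∸ 1) ^ 2)
lemma5 {n} f k 1≤k M =
  (λ c rep cM≢0 → low-sensitivity-bound f k 1≤k M (replicate n false) (cM≢0 ∘ trans (sym (Δ-representation f c M rep)))) ,
  fourier-low-sensitivity-bound f k 1≤k M
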